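{- Let $(G_n)_{n\in\mathbb{N}}$ be an arbitrary family of $3$-regular connected undirected graphs with edge sets $E_n$, and for each $n$ let $\Gamma_n$ be the group of edge flips of $G_n$. There is a constant $c$ such that for every $n\in\mathbb{N}$ and every choice of $u_n\in V(G_n)$, there exists a $\Gamma_n$-symmetric $\vec y$-linear IPS refutation over $\mathbb{F}_2$ of the unsatisfiable system $\mathrm{CFI}(G_n,u_n,1)$ of size at most $c\cdot 2^{|E_n|}$.
   Context: CFI equations: for a $3$-regular connected undirected graph $G=(V,E)$, a vertex $u\in V$ and $a\in\{0,1\}$, $\mathrm{CFI}(G,u,a)$ is the system over $\mathbb{F}_2$ with variables $X=\{x^e_i: e\in E, i\in\mathbb{F}_2\}$ and polynomials: $x^e_i+x^f_j+x^g_k-(i+j+k)$ for every $v\in V\setminus\{u\}$ with $\{e,f,g\}=E(v)$ (the edges incident to $v$) and every $i,j,k\in\mathbb{F}_2$; $x^e_i+x^f_j+x^g_k-(i+j+k+a)$ for $\{e,f,g\}=E(u)$ and every $i,j,k\in\mathbb{F}_2$; $x^e_0+x^e_1-1$ for every $e\in E$; and $x^2-x$ for every $x\in X$. It is unsatisfiable iff $a=1$. The edge-flip group $\Gamma$ is the subgroup of $(\mathbb{F}_2^{E},+)$ of all vectors $\pi$ with $\sum_{e\in E(v)}\pi_e=0$ for every $v\in V$, acting on $X$ by $\pi(x^e_i)=x^e_{i+\pi_e}$; $\mathrm{CFI}(G,u,a)$ is $\Gamma$-invariant. An algebraic circuit over variables $Z$ and field $\mathbb{F}$ is a connected DAG with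 input gates labelled by elements of $Z\cup\mathbb{F}$ and internal gates labelled $+$ or $\times$ (arbitrary fan-in), single output, computing a polynomial. It is $\Gamma$-symmetric (for $\Gamma$ acting on $Z$, trivially on $\mathbb{F}$) if each $\pi\in\Gamma$ extends to a DAG automorphism preserving internal labels and mapping each input gate labelled $z$ to one labelled $\pi(z)$. IPS: for $\mathcal{F}=\{f_1,\dots,f_m\}$ and fresh $Y=\{y_1,\dots,y_m\}$, an IPS certificate is $C(\vec x,\vec y)$ with $C(\vec x,\vec 0)=0$, $C(\vec x,f_1,\dots,f_m)=1$; an IPS refutation is a circuit over $X\uplus Y$ computing one; its size is $\max(\text{number of gates},|X|+|Y|)$; it is $\vec y$-linear if the certificate is $\sum_iy_ig_i(\vec x)$ with $g_i\in\mathbb{F}[X]$. For $\Gamma$-invariant $\mathcal{F}$, $\Gamma$ acts on $Y$ by $\pi(y_i)=y_j$ where $\pi(f_i)=f_j$; a $\Gamma$-symmetric IPS refutation is one that is a $\Gamma$-symmetric circuit w.r.t. this action on $X\uplus Y$. -}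

module Defs where

open import Data.Nat using (ℕ; zero; suc; _+_; _*_; _<_; _⊔_)
open import Data.Bool using (Bool; true; false; _xor_; _∧_; if_then_else_)
open import Data.Fin using (Fin; toℕ; _≟_) renaming (zero to f0; suc to fs)
open import Data.Fin.Permutation using (Permutation′; _⟨$⟩ʳ_)
open import Data.Product using (Σ; ∃; _×_; _,_; proj₁; proj₂)
open import Data.Sum using (_⊎_; inj₁; inj₂)
open import Data.List using (List; []; _∷_; map; foldr; filterᵇ; concatMap; _++_)
open import Data.List using () renaming (allFin to allFinL)
open import Data.Empty using (⊥)
open import Data.Unit using (⊤)
open import Function using (Injective)
open import Function.Bundles using (_⇔_)
open import Relation.Nullary using (does; ¬_)
open import Relation.Binary.PropositionalEquality using (_≡_; _≢_)
open import Relation.Binary.Construct.Closure.ReflexiveTransitive using (Star)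

-- Field F₂ : Bool with xor as addition and ∧ as multiplication.
-- (In characteristic 2, subtraction coincides with addition.)

F₂ : Set
F₂ = Bool

-- Poly Z are polynomial expressions; _≈_ is the congruence generated by the
-- axioms of commutative F₂-algebras, so Poly Z / _≈_ is the polynomial ring
-- F₂[Z] (the free commutative F₂-algebra on Z).

infixl 6 _⊕_
infixl 7 _⊗_

data Poly (Z : Set) : Set where
  con : F₂ → Poly Z
  var : Z → Poly Z
  _⊕_ : Poly Z → Poly Z → Poly Z
  _⊗_ : Poly Z → Poly Z → Poly Z

infix 4 _≈_

data _≈_ {Z : Set} : Poly Z → Poly Z → Set where
  ≈-refl   : ∀ {p} → p ≈ p
  ≈-sym    : ∀ {p q} → p ≈ q → q ≈ p
  ≈-trans  : ∀ {p q r} → p ≈ q → q ≈ r → p ≈ r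
  ⊕-cong   : ∀ {p p′ q q′} → p ≈ p′ → q ≈ q′ → p ⊕ q ≈ p′ ⊕ q′
  ⊗-cong   : ∀ {p p′ q q′} → p ≈ p′ → q ≈ q′ → p ⊗ q ≈ p′ ⊗ q′
  ⊕-assoc  : ∀ p q r → (p ⊕ q) ⊕ r ≈ p ⊕ (q ⊕ r)
  ⊕-comm   : ∀ p q → p ⊕ q ≈ q ⊕ p
  ⊕-idˡ    : ∀ p → con false ⊕ p ≈ p
  ⊕-self   : ∀ p → p ⊕ p ≈ con false
  ⊗-assoc  : ∀ p q r → (p ⊗ q) ⊗ r ≈ p ⊗ (q ⊗ r)
  ⊗-comm   : ∀ p q → p ⊗ q ≈ q ⊗ p
  ⊗-idˡ    : ∀ p → con true ⊗ p ≈ p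
  distribˡ : ∀ p q r → p ⊗ (q ⊕ r) ≈ (p ⊗ q) ⊕ (p ⊗ r)
  con-+    : ∀ a b → con a ⊕ con b ≈ con (a xor b)
  con-*    : ∀ a b → con a ⊗ con b ≈ con (a ∧ b)

subst : {Z W : Set} → (Z → Poly W) → Poly Z → Poly W
subst σ (con a) = con a
subst σ (var z) = σ z
subst σ (p ⊕ q) = subst σ p ⊕ subst σ q
subst σ (p ⊗ q) = subst σ p ⊗ subst σ q

rename : {Z W : Set} → (Z → W) → Poly Z → Poly W
rename f = subst (λ z → var (f z))

ΣP : {Z : Set} → List (Poly Z) → Poly Z
ΣP = foldr _⊕_ (con false)

ΠP : {Z : Set} → List (Poly Z) → Poly Z
ΠP = foldr _⊗_ (con true)

-- Gates are Fin size; child g h = true means there is a wire h → g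
-- (h is an input of g).  Input gates (labelled by a variable or a field constant) are
-- exactly the gates without incoming wires; there is a single output gate,
-- which is the unique sink (this also makes the DAG connected).

data Label (Z : Set) : Set where
  inp   : Z → Label Z
  cst   : F₂ → Label Z
  plus  : Label Z
  times : Label Z

IsInputLabel : {Z : Set} → Label Z → Set
IsInputLabel (inp _) = ⊤
IsInputLabel (cst _) = ⊤
IsInputLabel plus    = ⊥
IsInputLabel times   = ⊥

mapLabel : {Z W : Set} → (Z → W) → Label Z → Label W
mapLabel f (inp z) = inp (f z)
mapLabel f (cst a) = cst a
mapLabel f plus    = plus
mapLabel f times   = times

record Circuit (Z : Set) : Set where
  field
    size        : ℕ
    label       : Fin size → Label Z
    child       : Fin size → Fin size → Bool
    acyclic     : ∀ g h → child g h ≡ true → toℕ h < toℕ g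
    input-leaf  : ∀ g → IsInputLabel (label g) → ∀ h → child g h ≡ false
    internal-fan : ∀ g → ¬ IsInputLabel (label g) → ∃ λ h → child g h ≡ true
    output      : Fin size
    output-sink : ∀ g → child g output ≡ false
    other-used  : ∀ h → h ≢ output → ∃ λ g → child g h ≡ true

module _ {Z : Set} (C : Circuit Z) where
  open Circuit C

  children : Fin size → List (Fin size)
  children g = filterᵇ (child g) (allFinL size)

  -- evaluation with fuel; fuel = size suffices by acyclicity
  evalF : ℕ → Fin size → Poly Z
  evalF zero    g = con false
  evalF (suc n) g with label g
  ... | inp z = var z
  ... | cst a = con a
  ... | plus  = ΣP (map (evalF n) (children g))
  ... | times = ΠP (map (evalF n) (children g))

  computes : Poly Z
  computes = evalF size output

IsSymmetric : {Z : Set} (Γ : Set) (act : Γ → Z → Z) → Circuit Z → Set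
IsSymmetric Γ act C =
  ∀ (π : Γ) → Σ (Permutation′ size) λ σ →
      (∀ g h → child (σ ⟨$⟩ʳ g) (σ ⟨$⟩ʳ h) ≡ child g h)
    × (∀ g → label (σ ⟨$⟩ʳ g) ≡ mapLabel (act π) (label g))
  where open Circuit C

record CubicGraph : Set where
  field
    nv ne     : ℕ
    ends      : Fin ne → Fin nv × Fin nv
    loopless  : ∀ e → proj₁ (ends e) ≢ proj₂ (ends e)
    no-multi  : ∀ e e′ → (ends e ≡ ends e′ ⊎ ends e ≡ (proj₂ (ends e′) , proj₁ (ends e′))) → e ≡ e′
    inc       : Fin nv → Fin 3 → Fin ne
    inc-inj   : ∀ v → Injective _≡_ _≡_ (inc v)
    inc-spec  : ∀ v e → (proj₁ (ends e) ≡ v ⊎ proj₂ (ends e) ≡ v) ⇔ (∃ λ t → inc v t ≡ e)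
    connected : ∀ v w → Star (λ a b → ∃ λ e → ends e ≡ (a , b) ⊎ ends e ≡ (b , a)) v w

module _ (G : CubicGraph) where
  open CubicGraph G

  e₀ e₁ e₂ : Fin nv → Fin ne
  e₀ v = inc v f0
  e₁ v = inc v (fs f0)
  e₂ v = inc v (fs (fs f0))

  XVar : Set
  XVar = Fin ne × F₂

  data CFIIdx : Set where
    vtx  : Fin nv → F₂ → F₂ → F₂ → CFIIdx
    edg  : Fin ne → CFIIdx
    bool : XVar → CFIIdx

  bools : List F₂
  bools = false ∷ true ∷ []

  allXVar : List XVar
  allXVar = concatMap (λ e → map (λ i → (e , i)) bools) (allFinL ne)

  allCFIIdx : List CFIIdx
  allCFIIdx =
       concatMap (λ v → concatMap (λ i → concatMap (λ j → map (λ k → vtx v i j k) bools) bools) bools) (allFinL nv)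
    ++ map edg (allFinL ne)
    ++ map bool allXVar

  -- the polynomials of CFI(G,u,a); over F₂, "- c" is "+ c"
  CFI : Fin nv → F₂ → CFIIdx → Poly XVar
  CFI u a (vtx v i j k) =
    var (e₀ v , i) ⊕ var (e₁ v , j) ⊕ var (e₂ v , k)
      ⊕ con (i xor j xor k xor (does (v ≟ u) ∧ a))
  CFI u a (edg e) = var (e , false) ⊕ var (e , true) ⊕ con true
  CFI u a (bool x) = var x ⊗ var x ⊕ var x

  Flip : Set
  Flip = Σ (Fin ne → F₂) λ π → ∀ v → π (e₀ v) xor π (e₁ v) xor π (e₂ v) ≡ false

  actX : Flip → XVar → XVar
  actX (π , _) (e , i) = (e , i xor π e)

  -- induced action on the indices (π(f_ι) = f_{actY π ι})
  actY : Flip → CFIIdx → CFIIdx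
  actY (π , p) (vtx v i j k) = vtx v (i xor π (e₀ v)) (j xor π (e₁ v)) (k xor π (e₂ v))
  actY (π , p) (edg e) = edg e
  actY (π , p) (bool x) = bool (actX (π , p) x)

  IPSVar : Set
  IPSVar = XVar ⊎ CFIIdx

  actXY : Flip → IPSVar → IPSVar
  actXY π (inj₁ x) = inj₁ (actX π x)
  actXY π (inj₂ y) = inj₂ (actY π y)

  -- |X| + |Y|
  numVars : ℕ
  numVars = 2 * ne + (8 * nv + ne + 2 * ne)

  ipsSize : Circuit IPSVar → ℕ
  ipsSize C = Circuit.size C ⊔ numVars

  IsYLinearIPSRefutation : Fin nv → F₂ → Circuit IPSVar → Set
  IsYLinearIPSRefutation u a C =
      (subst (λ { (inj₁ x) → var x ; (inj₂ y) → con false }) P ≈ con false)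
    × (subst (λ { (inj₁ x) → var x ; (inj₂ y) → CFI u a y }) P ≈ con true)
    × (Σ (CFIIdx → Poly XVar) λ g →
         P ≈ ΣP (map (λ y → var (inj₂ y) ⊗ rename inj₁ (g y)) allCFIIdx))
    where P = computes C

  IsSymYLinearIPSRefutation : Fin nv → F₂ → Circuit IPSVar → Set
  IsSymYLinearIPSRefutation u a C =
    IsSymmetric Flip actXY C × IsYLinearIPSRefutation u a C

{-# OPTIONS --safe #-}
module Submission where

-- Over 𝔽₂ the edge axioms give the telescoping identity
--   1 = ∏ₑ (xᵉ₀ + xᵉ₁) + ∑ₑ (1 + xᵉ₀ + xᵉ₁) ∏_{e′>e} (xᵉ′₀ + xᵉ′₁),
-- and ∏ₑ (xᵉ₀ + xᵉ₁) expands into the 2^|E| monomials mₛ = ∏ₑ xᵉ_{s(e)} of the edge assignments s.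
-- Each mₛ is absorbed by one vertex axiom: summed over all vertices, the parities of the vertex
-- constraints at s count every edge twice and u once, so some vertex v is violated by s, and its
-- axiom f satisfies f·mₛ = mₛ modulo the Boolean axioms at the three edges of v.  This gives a
-- y-linear certificate with O(2^|E|) terms, computed by a depth-3 circuit.  Choosing v from the
-- syndrome of s (its vector of vertex parities), which edge flips preserve, makes the circuit
-- invariant under the flip group.

open import Level using (0ℓ)
open import Algebra.Bundles using (CommutativeMonoid; CommutativeRing; RawRing)
import Algebra.Solver.CommutativeMonoid
open import Algebra.Solver.Ring.AlmostCommutativeRing using (fromCommutativeRing; _-Raw-AlmostCommutative⟶_)
open import Data.Bool using (Bool; true; false; not; _xor_; _∧_; if_then_else_)
import Data.Bool as Bool
open import Data.Bool.Properties using (T-≡; xor-∧-commutativeRing; xor-assoc; xor-identityʳ; xor-same)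
open import Data.Empty using (⊥; ⊥-elim)
open import Data.Fin using (Fin; toℕ; _≟_; splitAt; join; remQuot; combine) renaming (zero to 0F; suc to sucF)
open import Data.Fin.Patterns using (1F; 2F)
open import Data.Fin.Permutation using (permutation)
open import Data.Fin.Properties
  using (_<?_; any?; splitAt-join; join-splitAt; remQuot-combine; combine-remQuot; toℕ-↑ˡ; toℕ-↑ʳ; toℕ<n; injective⇒≤)
open import Data.List
  using (List; []; _∷_; map; foldr; filterᵇ; _++_; concatMap; cartesianProduct; cartesianProductWith; tabulate; allFin)
open import Data.List.Properties using (map-∘; map-tabulate)
open import Data.List.Membership.Propositional using (_∈_)
open import Data.List.Membership.Propositional.Properties
  using (∈-map⁺; ∈-map⁻; ∈-tabulate⁺; ∈-allFin; ∈-++⁺ˡ; ∈-++⁺ʳ; ∈-++⁻; ∈-filter⁺; ∈-filter⁻;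
         ∈-cartesianProduct⁺; ∈-cartesianProductWith⁺; ∈-cartesianProductWith⁻)
open import Data.List.Membership.Propositional.Properties.WithK using (unique∧set⇒bag)
open import Data.List.Relation.Unary.Any using (here; there)
open import Data.List.Relation.Unary.All using (All; []; _∷_)
open import Data.List.Relation.Unary.All.Properties using (All¬⇒¬Any)
open import Data.List.Relation.Unary.AllPairs using ([]; _∷_)
open import Data.List.Relation.Unary.Unique.Propositional using (Unique)
import Data.List.Relation.Unary.Unique.Propositional.Properties as Unique
open import Data.List.Relation.Binary.BagAndSetEquality using (∼bag⇒↭)
open import Data.List.Relation.Binary.Permutation.Propositional using (_↭_; ↭⇒↭ₛ′)
import Data.List.Relation.Binary.Permutation.Propositional.Properties as ↭
import Data.List.Relation.Binary.Permutation.Setoid.Properties as ↭ₛ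
open import Data.Maybe using (Maybe; just; nothing)
open import Data.Nat using (ℕ; zero; suc; _+_; _*_; _^_; _<_; _≤_; z≤n; s≤s)
open import Data.Nat.Properties
  using (≤-trans; <-≤-trans; +-mono-≤; +-monoˡ-≤; +-monoʳ-≤; +-monoʳ-<; *-monoʳ-≤; *-monoˡ-≤; m≤m+n; ⊔-lub;
         m^n>0; module ≤-Reasoning)
open import Data.Nat.Solver using (module +-*-Solver)
open import Data.Product using (Σ; ∃; _×_; _,_; proj₁; proj₂; uncurry)
import Data.Product as Product
open import Data.Product.Properties using () renaming (≡-dec to ×-≡-dec)
open import Data.Sum using (_⊎_; inj₁; inj₂; [_,_])
import Data.Sum as ⊎
open import Data.Sum.Properties using () renaming (≡-dec to ⊎-≡-dec)
open import Data.Unit using (⊤; tt)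
open import Data.Vec using (Vec; []; _∷_; lookup)
import Data.Vec as Vec
open import Data.Vec.Properties using (lookup∘tabulate; tabulate-cong; tabulate∘lookup) renaming (≡-dec to Vec-≡-dec)
open import Function using (_∘_; _⇔_; _↔_; mk⇔; mk↔ₛ′; Equivalence; Inverse)
open import Relation.Binary.Definitions using (DecidableEquality)
import Relation.Binary.PropositionalEquality as ≡
open ≡ using (_≡_; _≢_; refl; sym; trans; cong; cong₂)
open import Relation.Nullary using (Dec; does; yes; no; ¬_; contradiction; _⊎-dec_; _×-dec_)
open import Relation.Nullary.Decidable using (T?; dec-true; dec-false; does-⇔; map′)

private variable A B : Set

-- Big operators over lists

does⇔ : ∀ {P : Set} (P? : Dec P) → does P? ≡ true ⇔ P
does⇔ (yes p)  = mk⇔ (λ _ → p) (λ _ → refl)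
does⇔ (no ¬p) = mk⇔ (λ ()) (λ p → contradiction p ¬p)

unique-↭ : ∀ {xs ys : List A} → Unique xs → Unique ys → (∀ {a} → a ∈ xs ⇔ a ∈ ys) → xs ↭ ys
unique-↭ xs-unique ys-unique same-elements = ∼bag⇒↭ (unique∧set⇒bag xs-unique ys-unique same-elements)

module BigOperator {c ℓ} (M : CommutativeMonoid c ℓ) where
  open CommutativeMonoid M renaming (refl to ≈-refl; sym to ≈-sym; trans to ≈-trans)
  open import Algebra.Properties.CommutativeSemigroup commutativeSemigroup using (interchange)

  big : List A → (A → Carrier) → Carrier
  big xs f = foldr _∙_ ε (map f xs)

  big-cong-≡ : ∀ (xs : List A) {f g : A → Carrier} → (∀ x → f x ≡ g x) → big xs f ≡ big xs g
  big-cong-≡ []       f≡g = refl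
  big-cong-≡ (x ∷ xs) f≡g = cong₂ _∙_ (f≡g x) (big-cong-≡ xs f≡g)

  big-cong : ∀ (xs : List A) {f g : A → Carrier} → (∀ x → f x ≈ g x) → big xs f ≈ big xs g
  big-cong []       f≈g = ≈-refl
  big-cong (x ∷ xs) f≈g = ∙-cong (f≈g x) (big-cong xs f≈g)

  big-ε : ∀ (xs : List A) {f : A → Carrier} → (∀ x → f x ≈ ε) → big xs f ≈ ε
  big-ε []       f≈ε = ≈-refl
  big-ε (x ∷ xs) f≈ε = ≈-trans (∙-cong (f≈ε x) (big-ε xs f≈ε)) (identityˡ ε)

  big-++ : ∀ (xs ys : List A) (f : A → Carrier) → big (xs ++ ys) f ≈ big xs f ∙ big ys f
  big-++ []       ys f = ≈-sym (identityˡ _)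
  big-++ (x ∷ xs) ys f = ≈-trans (∙-congˡ (big-++ xs ys f)) (≈-sym (assoc _ _ _))

  big-distrib : ∀ (xs : List A) (f g : A → Carrier) → big xs (λ x → f x ∙ g x) ≈ big xs f ∙ big xs g
  big-distrib []       f g = ≈-sym (identityˡ ε)
  big-distrib (x ∷ xs) f g = ≈-trans (∙-congˡ (big-distrib xs f g)) (interchange _ _ _ _)

  big-comm : ∀ (xs : List A) (ys : List B) (f : A → B → Carrier) →
             big xs (λ x → big ys (f x)) ≈ big ys (λ y → big xs (λ x → f x y))
  big-comm []       ys f = ≈-sym (big-ε ys (λ _ → ≈-refl))
  big-comm (x ∷ xs) ys f = ≈-trans (∙-congˡ (big-comm xs ys f)) (≈-sym (big-distrib ys (f x) _))

  big-map : ∀ (g : B → A) (xs : List B) (f : A → Carrier) → big (map g xs) f ≡ big xs (f ∘ g)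
  big-map g xs f = cong (foldr _∙_ ε) (sym (map-∘ xs))

  big-tabulate : ∀ {n} (g : Fin n → A) (f : A → Carrier) → big (tabulate g) f ≡ big (allFin n) (f ∘ g)
  big-tabulate g f = cong (foldr _∙_ ε) (trans (map-tabulate g f) (sym (map-tabulate (λ i → i) (f ∘ g))))

  big-allFin-suc : ∀ {n} (f : Fin (suc n) → Carrier) → big (allFin (suc n)) f ≡ f 0F ∙ big (allFin n) (f ∘ sucF)
  big-allFin-suc f = cong (f 0F ∙_) (big-tabulate sucF f)

  big-cartesianProduct : ∀ (xs : List A) (ys : List B) (f : A × B → Carrier) →
                         big (cartesianProduct xs ys) f ≈ big xs (λ x → big ys (λ y → f (x , y)))
  big-cartesianProduct []       ys f = ≈-refl
  big-cartesianProduct (x ∷ xs) ys f = ≈-trans (big-++ (map (x ,_) ys) _ f)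
    (∙-cong (reflexive (big-map (x ,_) ys f)) (big-cartesianProduct xs ys f))

  big-filter : ∀ (p : A → Bool) (xs : List A) {f g : A → Carrier} → (∀ x → p x ≡ true → f x ≈ g x) →
               big (filterᵇ p xs) f ≈ big xs (λ x → if p x then g x else ε)
  big-filter p []       f≈g = ≈-refl
  big-filter p (x ∷ xs) f≈g with p x in px
  ... | true  = ∙-cong (f≈g x px) (big-filter p xs f≈g)
  ... | false = ≈-trans (big-filter p xs f≈g) (≈-sym (identityˡ _))

  big-↭ : ∀ {xs ys : List A} (f : A → Carrier) → xs ↭ ys → big xs f ≈ big ys f
  big-↭ f xs↭ys = ↭ₛ.foldr-commMonoid setoid isCommutativeMonoid (↭⇒↭ₛ′ isEquivalence (↭.map⁺ f xs↭ys))

  big-select : ∀ (p : A → Bool) {xs ys} (f : A → Carrier) → Unique xs → (∀ x → x ∈ xs) → Unique ys →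
               (∀ {x} → x ∈ ys ⇔ p x ≡ true) → big xs (λ x → if p x then f x else ε) ≈ big ys f
  big-select p {xs} {ys} f xs-unique xs-complete ys-unique ys⇔p =
    ≈-trans (≈-sym (big-filter p xs {f} (λ _ _ → ≈-refl)))
            (big-↭ f (unique-↭ (Unique.filter⁺ (T? ∘ p) xs-unique) ys-unique (mk⇔ selected⇒ys ys⇒selected)))
    where
    selected⇒ys : ∀ {x} → x ∈ filterᵇ p xs → x ∈ ys
    selected⇒ys x∈ = Equivalence.from ys⇔p (Equivalence.to T-≡ (proj₂ (∈-filter⁻ (T? ∘ p) {xs = xs} x∈)))
    ys⇒selected : ∀ {x} → x ∈ ys → x ∈ filterᵇ p xs
    ys⇒selected x∈ys = ∈-filter⁺ (T? ∘ p) (xs-complete _) (Equivalence.from T-≡ (Equivalence.to ys⇔p x∈ys))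

  module _ (_≟_ : DecidableEquality A) where

    big-δ : ∀ {xs} (f : A → Carrier) {a} → Unique xs → a ∈ xs →
            big xs (λ x → if does (a ≟ x) then f x else ε) ≈ f a
    big-δ f {a} (a∉xs ∷ _) (here refl) with a ≟ a
    ... | yes _  = ≈-trans (∙-congˡ (vanish a∉xs)) (identityʳ (f a))
      where
      vanish : ∀ {ys} → All (a ≢_) ys → big ys (λ x → if does (a ≟ x) then f x else ε) ≈ ε
      vanish []                   = ≈-refl
      vanish {y ∷ _} (a≢y ∷ a∉ys) with a ≟ y
      ... | yes a≡y = contradiction a≡y a≢y
      ... | no  _   = ≈-trans (identityˡ _) (vanish a∉ys)
    ... | no a≢a = contradiction refl a≢a
    big-δ {x ∷ _} f {a} (x∉xs ∷ unique) (there a∈xs) with a ≟ x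
    ... | yes refl = contradiction a∈xs (All¬⇒¬Any x∉xs)
    ... | no  _    = ≈-trans (identityˡ _) (big-δ f unique a∈xs)

    big-split : ∀ {xs} (f : A → Carrier) {a} → Unique xs → a ∈ xs →
                big xs f ≈ f a ∙ big xs (λ x → if does (a ≟ x) then ε else f x)
    big-split {xs} f {a} unique a∈xs = ≈-trans (big-cong xs (λ x → split-if (does (a ≟ x)) (f x)))
      (≈-trans (big-distrib xs _ _) (∙-congʳ (big-δ f unique a∈xs)))
      where
      split-if : ∀ b y → y ≈ (if b then y else ε) ∙ (if b then ε else y)
      split-if true  y = ≈-sym (identityʳ y)
      split-if false y = ≈-sym (identityˡ y)

-- Finite enumerations

record Enumeration (A : Set) : Set where
  field
    size          : ℕ
    decode        : Fin size → A
    encode        : A → Fin size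
    decode-encode : ∀ a → decode (encode a) ≡ a
    encode-decode : ∀ i → encode (decode i) ≡ i

  encode-injective : ∀ {a b} → encode a ≡ encode b → a ≡ b
  encode-injective {a} {b} eq = trans (sym (decode-encode a)) (trans (cong decode eq) (decode-encode b))

  elements : List A
  elements = tabulate decode

  elements-unique : Unique elements
  elements-unique = Unique.tabulate⁺ λ {i} {j} eq → trans (sym (encode-decode i)) (trans (cong encode eq) (encode-decode j))

  ∈-elements : ∀ a → a ∈ elements
  ∈-elements a = ≡.subst (_∈ elements) (decode-encode a) (∈-tabulate⁺ (encode a))

  elements-↭ : ∀ {xs} → Unique xs → (∀ a → a ∈ xs) → elements ↭ xs
  elements-↭ xs-unique xs-complete = unique-↭ elements-unique xs-unique (mk⇔ (λ _ → xs-complete _) (λ _ → ∈-elements _))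

open Enumeration

finEnum : ∀ n → Enumeration (Fin n)
finEnum n = record
  { size = n ; decode = λ i → i ; encode = λ i → i ; decode-encode = λ _ → refl ; encode-decode = λ _ → refl }

boolEnum : Enumeration Bool
boolEnum = record
  { size          = 2
  ; decode        = λ { 0F → false ; 1F → true }
  ; encode        = λ { false → 0F ; true → 1F }
  ; decode-encode = λ { false → refl ; true → refl }
  ; encode-decode = λ { 0F → refl ; 1F → refl } }

⊤Enum : Enumeration ⊤
⊤Enum = record
  { size = 1 ; decode = λ _ → tt ; encode = λ _ → 0F ; decode-encode = λ _ → refl ; encode-decode = λ { 0F → refl } }

_⊎ₑ_ : Enumeration A → Enumeration B → Enumeration (A ⊎ B)
EA ⊎ₑ EB = record
  { size          = size EA + size EB
  ; decode        = decodes ∘ splitAt (size EA)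
  ; encode        = join (size EA) (size EB) ∘ encodes
  ; decode-encode = λ c → trans (cong decodes (splitAt-join (size EA) (size EB) (encodes c))) (decodes-encodes c)
  ; encode-decode = λ i → trans (cong (join (size EA) (size EB)) (encodes-decodes (splitAt (size EA) i)))
                                (join-splitAt (size EA) (size EB) i) }
  where
  decodes = ⊎.map (decode EA) (decode EB)
  encodes = ⊎.map (encode EA) (encode EB)
  decodes-encodes : ∀ c → decodes (encodes c) ≡ c
  decodes-encodes (inj₁ a) = cong inj₁ (decode-encode EA a)
  decodes-encodes (inj₂ b) = cong inj₂ (decode-encode EB b)
  encodes-decodes : ∀ c → encodes (decodes c) ≡ c
  encodes-decodes (inj₁ i) = cong inj₁ (encode-decode EA i)
  encodes-decodes (inj₂ j) = cong inj₂ (encode-decode EB j)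

_×ₑ_ : Enumeration A → Enumeration B → Enumeration (A × B)
EA ×ₑ EB = record
  { size          = size EA * size EB
  ; decode        = Product.map (decode EA) (decode EB) ∘ unpair
  ; encode        = uncurry combine ∘ Product.map (encode EA) (encode EB)
  ; decode-encode = λ (a , b) → trans (cong (Product.map (decode EA) (decode EB)) (remQuot-combine (encode EA a) (encode EB b)))
                                      (cong₂ _,_ (decode-encode EA a) (decode-encode EB b))
  ; encode-decode = λ i → trans (cong₂ combine (encode-decode EA (proj₁ (unpair i))) (encode-decode EB (proj₂ (unpair i))))
                                (combine-remQuot {size EA} (size EB) i) }
  where
  unpair : Fin (size EA * size EB) → Fin (size EA) × Fin (size EB)
  unpair = remQuot (size EB)

transport : (f : A → B) (g : B → A) → (∀ a → g (f a) ≡ a) → (∀ b → f (g b) ≡ b) →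
            Enumeration A → Enumeration B
transport f g gf fg E = record
  { size          = size E
  ; decode        = f ∘ decode E
  ; encode        = encode E ∘ g
  ; decode-encode = λ b → trans (cong f (decode-encode E (g b))) (fg b)
  ; encode-decode = λ i → trans (cong (encode E) (gf (decode E i))) (encode-decode E i) }

vecEnum : ∀ n → Enumeration (Vec Bool n)
vecEnum zero    = record { size = 1 ; decode = λ _ → [] ; encode = λ _ → 0F
                         ; decode-encode = λ { [] → refl } ; encode-decode = λ { 0F → refl } }
vecEnum (suc n) = transport (uncurry _∷_) (λ { (b ∷ s) → b , s }) (λ _ → refl) (λ { (b ∷ s) → refl })
                            (boolEnum ×ₑ vecEnum n)

vecEnum-size : ∀ n → size (vecEnum n) ≡ 2 ^ n
vecEnum-size zero    = refl
vecEnum-size (suc n) = cong (2 *_) (vecEnum-size n)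

module _ (EA : Enumeration A) (EB : Enumeration B) where

  encode-inj₁<inj₂ : ∀ a b → toℕ (encode (EA ⊎ₑ EB) (inj₁ a)) < toℕ (encode (EA ⊎ₑ EB) (inj₂ b))
  encode-inj₁<inj₂ a b rewrite toℕ-↑ˡ (encode EA a) (size EB) | toℕ-↑ʳ (size EA) (encode EB b) =
    <-≤-trans (toℕ<n (encode EA a)) (m≤m+n _ _)

  encode-inj₂-mono : ∀ b b′ → toℕ (encode EB b) < toℕ (encode EB b′) →
                     toℕ (encode (EA ⊎ₑ EB) (inj₂ b)) < toℕ (encode (EA ⊎ₑ EB) (inj₂ b′))
  encode-inj₂-mono b b′ b<b′ rewrite toℕ-↑ʳ (size EA) (encode EB b) | toℕ-↑ʳ (size EA) (encode EB b′) =
    +-monoʳ-< (size EA) b<b′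

  elements-⊎-↭ : elements (EA ⊎ₑ EB) ↭ map inj₁ (elements EA) ++ map inj₂ (elements EB)
  elements-⊎-↭ = elements-↭ (EA ⊎ₑ EB)
    (Unique.++⁺ (Unique.map⁺ (λ { refl → refl }) (elements-unique EA))
                (Unique.map⁺ (λ { refl → refl }) (elements-unique EB))
                disjoint)
    λ { (inj₁ a) → ∈-++⁺ˡ (∈-map⁺ inj₁ (∈-elements EA a))
      ; (inj₂ b) → ∈-++⁺ʳ _ (∈-map⁺ inj₂ (∈-elements EB b)) }
    where
    disjoint : ∀ {c} → c ∈ map inj₁ (elements EA) × c ∈ map inj₂ (elements EB) → ⊥
    disjoint (p , q) with ∈-map⁻ inj₁ p | ∈-map⁻ inj₂ q
    ... | _ , _ , refl | _ , _ , ()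

  elements-×-↭ : elements (EA ×ₑ EB) ↭ cartesianProduct (elements EA) (elements EB)
  elements-×-↭ = elements-↭ (EA ×ₑ EB) (Unique.cartesianProduct⁺ (elements-unique EA) (elements-unique EB))
    λ (a , b) → ∈-cartesianProduct⁺ (∈-elements EA a) (∈-elements EB b)

module EnumerationSum {c ℓ} (M : CommutativeMonoid c ℓ) where
  open CommutativeMonoid M using (Carrier; _≈_; _∙_; ε; ∙-cong; ∙-congˡ; ∙-congʳ; identityˡ; identityʳ; reflexive)
    renaming (trans to ≈-trans)
  open BigOperator M

  module _ (EA : Enumeration A) (EB : Enumeration B) where

    big-⊎ : ∀ (f : A ⊎ B → Carrier) →
            big (elements (EA ⊎ₑ EB)) f ≈ big (elements EA) (f ∘ inj₁) ∙ big (elements EB) (f ∘ inj₂)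
    big-⊎ f = ≈-trans (big-↭ f (elements-⊎-↭ EA EB)) (≈-trans (big-++ (map inj₁ (elements EA)) _ f)
      (∙-cong (reflexive (big-map inj₁ (elements EA) f)) (reflexive (big-map inj₂ (elements EB) f))))

    big-inj₁ : ∀ (f : A ⊎ B → Carrier) → (∀ b → f (inj₂ b) ≈ ε) →
               big (elements (EA ⊎ₑ EB)) f ≈ big (elements EA) (f ∘ inj₁)
    big-inj₁ f f-inj₂ = ≈-trans (big-⊎ f) (≈-trans (∙-congˡ (big-ε (elements EB) f-inj₂)) (identityʳ _))

    big-inj₂ : ∀ (f : A ⊎ B → Carrier) → (∀ a → f (inj₁ a) ≈ ε) →
               big (elements (EA ⊎ₑ EB)) f ≈ big (elements EB) (f ∘ inj₂)
    big-inj₂ f f-inj₁ = ≈-trans (big-⊎ f) (≈-trans (∙-congʳ (big-ε (elements EA) f-inj₁)) (identityˡ _))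

    big-× : ∀ (f : A × B → Carrier) →
            big (elements (EA ×ₑ EB)) f ≈ big (elements EA) (λ a → big (elements EB) (λ b → f (a , b)))
    big-× f = ≈-trans (big-↭ f (elements-×-↭ EA EB)) (big-cartesianProduct (elements EA) (elements EB) f)

  big-vecEnum-suc : ∀ n (f : Vec Bool (suc n) → Carrier) →
                    big (elements (vecEnum (suc n))) f
                    ≈ big (elements boolEnum) (λ b → big (elements (vecEnum n)) (λ s → f (b ∷ s)))
  big-vecEnum-suc n f = ≈-trans (reflexive (trans (cong (λ xs → big xs f) (sym (map-tabulate (decode pairs) (uncurry _∷_))))
                                                  (big-map (uncurry _∷_) (elements pairs) f)))
                                (big-× boolEnum (vecEnum n) (f ∘ uncurry _∷_))
    where
    pairs = boolEnum ×ₑ vecEnum n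

-- Polynomials over 𝔽₂

open import Defs

polyRing : Set → CommutativeRing 0ℓ 0ℓ
polyRing Z = record
  { Carrier = Poly Z ; _≈_ = _≈_ ; _+_ = _⊕_ ; _*_ = _⊗_ ; -_ = λ p → p ; 0# = con false ; 1# = con true
  ; isCommutativeRing = record
    { isRing = record
      { +-isAbelianGroup = record
        { isGroup = record
          { isMonoid = record
            { isSemigroup = record
              { isMagma = record
                { isEquivalence = record { refl = ≈-refl ; sym = ≈-sym ; trans = ≈-trans }
                ; ∙-cong        = ⊕-cong }
              ; assoc = ⊕-assoc }
            ; identity = ⊕-idˡ , λ p → ≈-trans (⊕-comm p _) (⊕-idˡ p) }
          ; inverse = ⊕-self , ⊕-self
          ; ⁻¹-cong = λ p≈q → p≈q }
        ; comm = ⊕-comm }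
      ; *-cong     = ⊗-cong
      ; *-assoc    = ⊗-assoc
      ; *-identity = ⊗-idˡ , λ p → ≈-trans (⊗-comm p _) (⊗-idˡ p)
      ; distrib    = distribˡ , λ p q r → ≈-trans (⊗-comm _ p)
                                            (≈-trans (distribˡ p q r) (⊕-cong (⊗-comm p q) (⊗-comm p r))) }
    ; *-comm = ⊗-comm } }

≡⇒≈ : ∀ {Z} {p q : Poly Z} → p ≡ q → p ≈ q
≡⇒≈ refl = ≈-refl

𝔽₂ : RawRing 0ℓ 0ℓ
𝔽₂ = record { Carrier = Bool ; _≈_ = _≡_ ; _+_ = _xor_ ; _*_ = _∧_ ; -_ = λ a → a ; 0# = false ; 1# = true }

-- Normalising with coefficients in 𝔽₂ lets the solver prove identities such as p + p ≈ 0.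
module Char2Solver (Z : Set) where
  constant : 𝔽₂ -Raw-AlmostCommutative⟶ fromCommutativeRing (polyRing Z)
  constant = record
    { ⟦_⟧ = con ; +-homo = λ a b → ≈-sym (con-+ a b) ; *-homo = λ a b → ≈-sym (con-* a b)
    ; -‿homo = λ _ → ≈-refl ; 0-homo = ≈-refl ; 1-homo = ≈-refl }

  constant-≟ : ∀ a b → Maybe (con {Z} a ≈ con b)
  constant-≟ a b with a Bool.≟ b
  ... | yes refl = just ≈-refl
  ... | no _     = nothing

  open import Algebra.Solver.Ring 𝔽₂ (fromCommutativeRing (polyRing Z)) constant constant-≟ public
    using (solve; _:+_; _:*_; _:=_) renaming (con to κ)

module Sum {Z : Set} = BigOperator (CommutativeRing.+-commutativeMonoid (polyRing Z))
module Prod {Z : Set} = BigOperator (CommutativeRing.*-commutativeMonoid (polyRing Z))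
module SumE {Z : Set} = EnumerationSum (CommutativeRing.+-commutativeMonoid (polyRing Z))
module ProdE {Z : Set} = EnumerationSum (CommutativeRing.*-commutativeMonoid (polyRing Z))

∑ ∏ : {Z : Set} → List A → (A → Poly Z) → Poly Z
∑ = Sum.big
∏ = Prod.big

syntax ∑ xs (λ x → e) = ∑[ x ∈ xs ] e
syntax ∏ xs (λ x → e) = ∏[ x ∈ xs ] e

∑-distribˡ : ∀ {Z} (p : Poly Z) (xs : List A) (f : A → Poly Z) → p ⊗ ∑[ x ∈ xs ] f x ≈ ∑[ x ∈ xs ] (p ⊗ f x)
∑-distribˡ {Z = Z} p []       f = CommutativeRing.zeroʳ (polyRing Z) p
∑-distribˡ         p (x ∷ xs) f = ≈-trans (distribˡ p (f x) _) (⊕-cong ≈-refl (∑-distribˡ p xs f))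

module _ {Z W : Set} (σ : Z → Poly W) where

  subst-cong : ∀ {p q} → p ≈ q → subst σ p ≈ subst σ q
  subst-cong ≈-refl             = ≈-refl
  subst-cong (≈-sym p≈q)        = ≈-sym (subst-cong p≈q)
  subst-cong (≈-trans p≈q q≈r)  = ≈-trans (subst-cong p≈q) (subst-cong q≈r)
  subst-cong (⊕-cong p≈p′ q≈q′) = ⊕-cong (subst-cong p≈p′) (subst-cong q≈q′)
  subst-cong (⊗-cong p≈p′ q≈q′) = ⊗-cong (subst-cong p≈p′) (subst-cong q≈q′)
  subst-cong (⊕-assoc p q r)    = ⊕-assoc _ _ _
  subst-cong (⊕-comm p q)       = ⊕-comm _ _
  subst-cong (⊕-idˡ p)          = ⊕-idˡ _
  subst-cong (⊕-self p)         = ⊕-self _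
  subst-cong (⊗-assoc p q r)    = ⊗-assoc _ _ _
  subst-cong (⊗-comm p q)       = ⊗-comm _ _
  subst-cong (⊗-idˡ p)          = ⊗-idˡ _
  subst-cong (distribˡ p q r)   = distribˡ _ _ _
  subst-cong (con-+ a b)        = con-+ a b
  subst-cong (con-* a b)        = con-* a b

  subst-∑ : ∀ (xs : List A) (f : A → Poly Z) → subst σ (∑[ x ∈ xs ] f x) ≡ ∑[ x ∈ xs ] subst σ (f x)
  subst-∑ []       f = refl
  subst-∑ (x ∷ xs) f = cong (subst σ (f x) ⊕_) (subst-∑ xs f)

  subst-∏ : ∀ (xs : List A) (f : A → Poly Z) → subst σ (∏[ x ∈ xs ] f x) ≡ ∏[ x ∈ xs ] subst σ (f x)
  subst-∏ []       f = refl
  subst-∏ (x ∷ xs) f = cong (subst σ (f x) ⊗_) (subst-∏ xs f)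

  subst-if : ∀ b (p q : Poly Z) → subst σ (if b then p else q) ≡ (if b then subst σ p else subst σ q)
  subst-if true  p q = refl
  subst-if false p q = refl

module _ {W : Set} where
  open CommutativeRing (polyRing W) using (+-identityʳ; *-identityˡ; setoid)
  open import Relation.Binary.Reasoning.Setoid setoid
  open Char2Solver W

  expansion : ∀ n (w : Fin n → Bool → Poly W) →
              ∑[ s ∈ elements (vecEnum n) ] ∏[ e ∈ allFin n ] w e (lookup s e)
              ≈ ∏[ e ∈ allFin n ] (w e false ⊕ w e true)
  expansion zero    w = +-identityʳ (con true)
  expansion (suc n) w = begin
    ∑[ s ∈ elements (vecEnum (suc n)) ] ∏[ e ∈ allFin (suc n) ] w e (lookup s e)
      ≈⟨ SumE.big-vecEnum-suc n _ ⟩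
    ∑[ b ∈ elements boolEnum ] ∑[ s ∈ elements (vecEnum n) ] ∏[ e ∈ allFin (suc n) ] w e (lookup (b ∷ s) e)
      ≈⟨ Sum.big-cong (elements boolEnum) (λ b → Sum.big-cong (elements (vecEnum n))
           (λ s → ≡⇒≈ (Prod.big-allFin-suc (λ e → w e (lookup (b ∷ s) e))))) ⟩
    ∑[ b ∈ elements boolEnum ] ∑[ s ∈ elements (vecEnum n) ] (w 0F b ⊗ tail s)
      ≈⟨ Sum.big-cong (elements boolEnum) (λ b → ≈-sym (∑-distribˡ (w 0F b) (elements (vecEnum n)) tail)) ⟩
    ∑[ b ∈ elements boolEnum ] (w 0F b ⊗ ∑[ s ∈ elements (vecEnum n) ] tail s)
      ≈⟨ Sum.big-cong (elements boolEnum) (λ b → ⊗-cong (≈-refl {p = w 0F b}) (expansion n (w ∘ sucF))) ⟩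
    ∑[ b ∈ elements boolEnum ] (w 0F b ⊗ rest)
      ≈⟨ solve 3 (λ a b r → a :* r :+ (b :* r :+ κ false) := (a :+ b) :* r) ≈-refl (w 0F false) (w 0F true) rest ⟩
    (w 0F false ⊕ w 0F true) ⊗ rest
      ≡⟨ Prod.big-allFin-suc (λ e → w e false ⊕ w e true) ⟨
    ∏[ e ∈ allFin (suc n) ] (w e false ⊕ w e true) ∎
    where
    tail : Vec Bool n → Poly W
    tail s = ∏[ e ∈ allFin n ] w (sucF e) (lookup s e)
    rest : Poly W
    rest = ∏[ e ∈ allFin n ] (w (sucF e) false ⊕ w (sucF e) true)

  telescope : ∀ n (S : Fin n → Poly W) →
              ∏[ e ∈ allFin n ] S e
              ⊕ ∑[ e ∈ allFin n ] ((S e ⊕ con true) ⊗ ∏[ e′ ∈ allFin n ] (if does (e <? e′) then S e′ else con true))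
              ≈ con true
  telescope zero    S = +-identityʳ (con true)
  telescope (suc n) S = begin
    ∏[ e ∈ allFin (suc n) ] S e ⊕ ∑[ e ∈ allFin (suc n) ] T e
      ≡⟨ cong₂ _⊕_ (Prod.big-allFin-suc S)
                   (trans (Sum.big-allFin-suc T) (cong₂ _⊕_ T-zero (Sum.big-cong-≡ (allFin n) T-suc))) ⟩
    S 0F ⊗ P ⊕ ((S 0F ⊕ con true) ⊗ (con true ⊗ P)
               ⊕ ∑[ e ∈ allFin n ] ((S (sucF e) ⊕ con true) ⊗ (con true ⊗ Q e)))
      ≈⟨ ⊕-cong ≈-refl (⊕-cong ≈-refl (Sum.big-cong (allFin n) (λ e → ⊗-cong ≈-refl (*-identityˡ (Q e))))) ⟩
    S 0F ⊗ P ⊕ ((S 0F ⊕ con true) ⊗ (con true ⊗ P) ⊕ R)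
      ≈⟨ solve 3 (λ s p r → s :* p :+ ((s :+ κ true) :* (κ true :* p) :+ r) := p :+ r) ≈-refl (S 0F) P R ⟩
    P ⊕ R
      ≈⟨ telescope n (S ∘ sucF) ⟩
    con true ∎
    where
    later : Fin (suc n) → Fin (suc n) → Poly W
    later e e′ = if does (e <? e′) then S e′ else con true
    T : Fin (suc n) → Poly W
    T e = (S e ⊕ con true) ⊗ ∏[ e′ ∈ allFin (suc n) ] later e e′
    P : Poly W
    P = ∏[ e ∈ allFin n ] S (sucF e)
    Q : Fin n → Poly W
    Q e = ∏[ e′ ∈ allFin n ] (if does (e <? e′) then S (sucF e′) else con true)
    R : Poly W
    R = ∑[ e ∈ allFin n ] ((S (sucF e) ⊕ con true) ⊗ Q e)
    T-zero : T 0F ≡ (S 0F ⊕ con true) ⊗ (con true ⊗ P)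
    T-zero = cong ((S 0F ⊕ con true) ⊗_) (Prod.big-allFin-suc (later 0F))
    T-suc : ∀ e → T (sucF e) ≡ (S (sucF e) ⊕ con true) ⊗ (con true ⊗ Q e)
    T-suc e = cong ((S (sucF e) ⊕ con true) ⊗_) (Prod.big-allFin-suc (later (sucF e)))

-- Circuits on an enumerated set of gates

gateOutput : ∀ {Z} → Label Z → Poly Z → Poly Z → Poly Z
gateOutput (inp z) _ _ = var z
gateOutput (cst a) _ _ = con a
gateOutput plus    s _ = s
gateOutput times   _ p = p

gateOutput-cong : ∀ {Z} (l : Label Z) {s s′ p p′ : Poly Z} → s ≈ s′ → p ≈ p′ →
                  gateOutput l s p ≈ gateOutput l s′ p′
gateOutput-cong (inp z) _    _    = ≈-refl
gateOutput-cong (cst a) _    _    = ≈-refl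
gateOutput-cong plus    s≈s′ _    = s≈s′
gateOutput-cong times   _    p≈p′ = p≈p′

evalF-suc : ∀ {Z} (C : Circuit Z) n i →
            evalF C (suc n) i ≡ gateOutput (Circuit.label C i) (ΣP (map (evalF C n) (children C i)))
                                                                (ΠP (map (evalF C n) (children C i)))
evalF-suc C n i with Circuit.label C i
... | inp z = refl
... | cst a = refl
... | plus  = refl
... | times = refl

record Netlist (Z : Set) : Set₁ where
  field
    Gate          : Set
    gates         : Enumeration Gate
    label         : Gate → Label Z
    wire          : Gate → Gate → Bool
    wire-descends : ∀ g h → wire g h ≡ true → toℕ (encode gates h) < toℕ (encode gates g)
    input-leaf    : ∀ g → IsInputLabel (label g) → ∀ h → wire g h ≡ false
    internal-fan  : ∀ g → ¬ IsInputLabel (label g) → ∃ λ h → wire g h ≡ true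
    output        : Gate
    output-sink   : ∀ g → wire g output ≡ false
    other-used    : ∀ h → h ≢ output → ∃ λ g → wire g h ≡ true

  open Enumeration gates using ()
    renaming (size to #gates; decode to gateAt; encode to indexOf; decode-encode to gateAt-indexOf; encode-decode to indexOf-gateAt)

  circuit : Circuit Z
  circuit = record
    { size         = #gates
    ; label        = label ∘ gateAt
    ; child        = λ i j → wire (gateAt i) (gateAt j)
    ; acyclic      = λ i j ij → ≡.subst₂ (λ a b → toℕ a < toℕ b) (indexOf-gateAt j) (indexOf-gateAt i)
                                         (wire-descends (gateAt i) (gateAt j) ij)
    ; input-leaf   = λ i leaf j → input-leaf (gateAt i) leaf (gateAt j)
    ; internal-fan = λ i internal → let h , ih = internal-fan (gateAt i) internal in
                       indexOf h , ≡.subst (λ k → wire (gateAt i) k ≡ true) (sym (gateAt-indexOf h)) ih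
    ; output       = indexOf output
    ; output-sink  = λ i → ≡.subst (λ k → wire (gateAt i) k ≡ false) (sym (gateAt-indexOf output)) (output-sink (gateAt i))
    ; other-used   = λ j j≢output →
                       let g , gj = other-used (gateAt j) (λ eq → j≢output (trans (sym (indexOf-gateAt j)) (cong indexOf eq))) in
                       indexOf g , ≡.subst (λ k → wire k (gateAt j) ≡ true) (sym (gateAt-indexOf g)) gj
    }

  IsEvaluation : (Gate → Poly Z) → Set
  IsEvaluation v = ∀ g → v g ≈ gateOutput (label g) (∑[ h ∈ elements gates ] (if wire g h then v h else con false))
                                                    (∏[ h ∈ elements gates ] (if wire g h then v h else con true))

  module _ (v : Gate → Poly Z) (v-evaluation : IsEvaluation v) where

    evalF-≈ : ∀ k i → toℕ i < k → evalF circuit k i ≈ v (gateAt i)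
    evalF-≈ (suc k) i (s≤s i≤k) = ≈-trans (≡⇒≈ (evalF-suc circuit k i))
      (≈-trans (gateOutput-cong (label (gateAt i)) inputs-sum inputs-product) (≈-sym (v-evaluation (gateAt i))))
      where
      child = Circuit.child circuit
      child-≈ : ∀ j → child i j ≡ true → evalF circuit k j ≈ v (gateAt j)
      child-≈ j ij = evalF-≈ k j (<-≤-trans (Circuit.acyclic circuit i j ij) i≤k)
      inputs-sum : ΣP (map (evalF circuit k) (children circuit i))
                   ≈ ∑[ h ∈ elements gates ] (if wire (gateAt i) h then v h else con false)
      inputs-sum = ≈-trans (Sum.big-filter (child i) (allFin #gates) child-≈) (≡⇒≈ (sym (Sum.big-tabulate gateAt _)))
      inputs-product : ΠP (map (evalF circuit k) (children circuit i))
                       ≈ ∏[ h ∈ elements gates ] (if wire (gateAt i) h then v h else con true)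
      inputs-product = ≈-trans (Prod.big-filter (child i) (allFin #gates) child-≈) (≡⇒≈ (sym (Prod.big-tabulate gateAt _)))

    computes-≈ : computes circuit ≈ v output
    computes-≈ = ≡.subst (λ g → computes circuit ≈ v g) (gateAt-indexOf output)
                         (evalF-≈ #gates (indexOf output) (toℕ<n _))

  symmetric : (Γ : Set) (act : Γ → Z → Z) (σ : Γ → Gate ↔ Gate) →
              (∀ π g h → wire (Inverse.to (σ π) g) (Inverse.to (σ π) h) ≡ wire g h) →
              (∀ π g → label (Inverse.to (σ π) g) ≡ mapLabel (act π) (label g)) →
              IsSymmetric Γ act circuit
  symmetric Γ act σ wire-σ label-σ π =
    permutation (indexOf ∘ to ∘ gateAt) (indexOf ∘ from ∘ gateAt)
                (conjugate {to} {from} strictlyInverseˡ) (conjugate {from} {to} strictlyInverseʳ)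
    , (λ i j → trans (cong₂ wire (gateAt-indexOf _) (gateAt-indexOf _)) (wire-σ π (gateAt i) (gateAt j)))
    , (λ i → trans (cong label (gateAt-indexOf _)) (label-σ π (gateAt i)))
    where
    open Inverse (σ π) using (to; from; strictlyInverseˡ; strictlyInverseʳ)
    conjugate : ∀ {f g : Gate → Gate} → (∀ x → f (g x) ≡ x) →
                ∀ i → indexOf (f (gateAt (indexOf (g (gateAt i))))) ≡ i
    conjugate {f} {g} fg i =
      trans (cong (indexOf ∘ f) (gateAt-indexOf _)) (trans (cong indexOf (fg _)) (indexOf-gateAt i))

-- Parity counting in cubic graphs

xor-cancelʳ : ∀ a p → (a xor p) xor p ≡ a
xor-cancelʳ a p = trans (xor-assoc a p p) (trans (cong (a xor_) (xor-same p)) (xor-identityʳ a))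

module Parity = BigOperator (CommutativeRing.+-commutativeMonoid xor-∧-commutativeRing)
module XorSolver = Algebra.Solver.CommutativeMonoid (CommutativeRing.+-commutativeMonoid xor-∧-commutativeRing)

module Handshake (G : CubicGraph) where
  open CubicGraph G

  endpoint? : ∀ e v → Dec (proj₁ (ends e) ≡ v ⊎ proj₂ (ends e) ≡ v)
  endpoint? e v = (proj₁ (ends e) ≟ v) ⊎-dec (proj₂ (ends e) ≟ v)

  isEndpoint : Fin ne → Fin nv → Bool
  isEndpoint e v = does (endpoint? e v)

  incident-parity : ∀ (f : Fin ne → Bool) v →
                    Parity.big (allFin ne) (λ e → if isEndpoint e v then f e else false) ≡ Parity.big (allFin 3) (f ∘ inc v)
  incident-parity f v = trans
    (Parity.big-select (λ e → isEndpoint e v) f (Unique.allFin⁺ ne) ∈-allFin (Unique.map⁺ (inc-inj v) (Unique.allFin⁺ 3))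
                       (mk⇔ incident⇒endpoint endpoint⇒incident))
    (Parity.big-map (inc v) (allFin 3) f)
    where
    incident⇒endpoint : ∀ {e} → e ∈ map (inc v) (allFin 3) → isEndpoint e v ≡ true
    incident⇒endpoint e∈ = let t , _ , e≡ = ∈-map⁻ (inc v) e∈ in
      Equivalence.from (does⇔ (endpoint? _ v)) (Equivalence.from (inc-spec v _) (t , sym e≡))
    endpoint⇒incident : ∀ {e} → isEndpoint e v ≡ true → e ∈ map (inc v) (allFin 3)
    endpoint⇒incident isEnd = let t , t≡ = Equivalence.to (inc-spec v _) (Equivalence.to (does⇔ (endpoint? _ v)) isEnd) in
      ≡.subst (_∈ _) t≡ (∈-map⁺ (inc v) (∈-allFin t))

  endpoints-parity : ∀ (b : Bool) e → Parity.big (allFin nv) (λ v → if isEndpoint e v then b else false) ≡ false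
  endpoints-parity b e = trans
    (Parity.big-select (λ v → isEndpoint e v) (λ _ → b) (Unique.allFin⁺ nv) ∈-allFin
                       (((λ p≡q → loopless e (sym p≡q)) ∷ []) ∷ [] ∷ [])
                       (mk⇔ endpoint⇒isEndpoint isEndpoint⇒endpoint))
    (trans (cong (b xor_) (xor-identityʳ b)) (xor-same b))
    where
    endpoint⇒isEndpoint : ∀ {v} → v ∈ proj₂ (ends e) ∷ proj₁ (ends e) ∷ [] → isEndpoint e v ≡ true
    endpoint⇒isEndpoint (here refl)         = dec-true (endpoint? e _) (inj₂ refl)
    endpoint⇒isEndpoint (there (here refl)) = dec-true (endpoint? e _) (inj₁ refl)
    isEndpoint⇒endpoint : ∀ {v} → isEndpoint e v ≡ true → v ∈ proj₂ (ends e) ∷ proj₁ (ends e) ∷ []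
    isEndpoint⇒endpoint isEnd = [ (λ { refl → there (here refl) }) , (λ { refl → here refl }) ]
                                  (Equivalence.to (does⇔ (endpoint? e _)) isEnd)

  handshake : ∀ (f : Fin ne → Bool) → Parity.big (allFin nv) (λ v → Parity.big (allFin 3) (f ∘ inc v)) ≡ false
  handshake f = begin
    Parity.big (allFin nv) (λ v → Parity.big (allFin 3) (f ∘ inc v))
      ≡⟨ Parity.big-cong (allFin nv) (incident-parity f) ⟨
    Parity.big (allFin nv) (λ v → Parity.big (allFin ne) (λ e → if isEndpoint e v then f e else false))
      ≡⟨ Parity.big-comm (allFin nv) (allFin ne) _ ⟩
    Parity.big (allFin ne) (λ e → Parity.big (allFin nv) (λ v → if isEndpoint e v then f e else false))
      ≡⟨ Parity.big-ε (allFin ne) (λ e → endpoints-parity (f e) e) ⟩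
    false ∎
    where open ≡.≡-Reasoning

module Violation (G : CubicGraph) (u : Fin (CubicGraph.nv G)) where
  open CubicGraph G
  open Handshake G
  open XorSolver using (_⊜_) renaming (_⊕_ to _⊞_; id to ∅)

  Assignment : Set
  Assignment = Vec Bool ne

  -- At the point xᵉᵢ = [s e ≡ i], the axiom vtx v (s e₀) (s e₁) (s e₂) of CFI(G,u,1) takes the value
  -- 1 + vertexParity s v, so s violates the constraint of v exactly when vertexParity s v ≡ false.
  vertexParity : Assignment → Fin nv → Bool
  vertexParity s v = lookup s (e₀ G v) xor lookup s (e₁ G v) xor lookup s (e₂ G v) xor (does (v ≟ u) ∧ true)

  vertexParities-odd : ∀ s → Parity.big (allFin nv) (vertexParity s) ≡ true
  vertexParities-odd s = begin
    Parity.big (allFin nv) (vertexParity s)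
      ≡⟨ Parity.big-cong (allFin nv) split ⟩
    Parity.big (allFin nv) (λ v → edgeParity v xor (if does (v ≟ u) then true else false))
      ≡⟨ Parity.big-distrib (allFin nv) edgeParity _ ⟩
    Parity.big (allFin nv) edgeParity xor Parity.big (allFin nv) (λ v → if does (v ≟ u) then true else false)
      ≡⟨ cong₂ _xor_ (handshake (lookup s)) only-u ⟩
    true ∎
    where
    open ≡.≡-Reasoning
    edgeParity : Fin nv → Bool
    edgeParity v = Parity.big (allFin 3) (lookup s ∘ inc v)
    ∧-true : ∀ b → b ∧ true ≡ (if b then true else false)
    ∧-true false = refl
    ∧-true true  = refl
    split : ∀ v → vertexParity s v ≡ edgeParity v xor (if does (v ≟ u) then true else false)
    split v = trans (XorSolver.solve 4 (λ a b c d → a ⊞ (b ⊞ (c ⊞ d)) ⊜ (a ⊞ (b ⊞ (c ⊞ ∅))) ⊞ d) refl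
                                       (lookup s (e₀ G v)) (lookup s (e₁ G v)) (lookup s (e₂ G v)) (does (v ≟ u) ∧ true))
                    (cong (edgeParity v xor_) (∧-true (does (v ≟ u))))
    only-u : Parity.big (allFin nv) (λ v → if does (v ≟ u) then true else false) ≡ true
    only-u = Parity.big-select (λ v → does (v ≟ u)) (λ _ → true) (Unique.allFin⁺ nv) ∈-allFin ([] ∷ [])
      (mk⇔ (λ { (here refl) → dec-true (u ≟ u) refl }) (λ v≡u → here (Equivalence.to (does⇔ (_ ≟ u)) v≡u)))

  not-all-even : ∀ s → ¬ (∀ v → vertexParity s v ≡ true)
  not-all-even s all-even = true≢false (begin
    true                                    ≡⟨ vertexParities-odd s ⟨
    Parity.big (allFin nv) (vertexParity s) ≡⟨ Parity.big-cong (allFin nv) all-even ⟩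
    Parity.big (allFin nv) (λ _ → true)     ≡⟨ handshake (λ _ → true) ⟩
    false                                   ∎)
    where
    open ≡.≡-Reasoning
    true≢false : true ≢ false
    true≢false ()

  firstFalse : Vec Bool nv → Fin nv
  firstFalse c with any? (λ v → lookup c v Bool.≟ false)
  ... | yes (v , _) = v
  ... | no  _       = u

  lookup-firstFalse : ∀ c → ¬ (∀ v → lookup c v ≡ true) → lookup c (firstFalse c) ≡ false
  lookup-firstFalse c not-all-true with any? (λ v → lookup c v Bool.≟ false)
  ... | yes (_ , cv≡false) = cv≡false
  ... | no  none           = ⊥-elim (not-all-true (λ v → not-false (λ cv≡false → none (v , cv≡false))))
    where
    not-false : ∀ {b} → b ≢ false → b ≡ true
    not-false {false} b≢false = ⊥-elim (b≢false refl)
    not-false {true}  _       = refl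

  syndrome : Assignment → Vec Bool nv
  syndrome s = Vec.tabulate (vertexParity s)

  -- Depends on s only through its syndrome, which edge flips preserve (violatedVertex-flip).
  violatedVertex : Assignment → Fin nv
  violatedVertex s = firstFalse (syndrome s)

  violatedVertex-parity : ∀ s → vertexParity s (violatedVertex s) ≡ false
  violatedVertex-parity s = trans (sym (lookup∘tabulate (vertexParity s) (violatedVertex s)))
    (lookup-firstFalse (syndrome s) λ all-true →
      not-all-even s λ v → trans (sym (lookup∘tabulate (vertexParity s) v)) (all-true v))

  flip : (Fin ne → Bool) → Assignment → Assignment
  flip π s = Vec.tabulate (λ e → lookup s e xor π e)

  lookup-flip : ∀ π s e → lookup (flip π s) e ≡ lookup s e xor π e
  lookup-flip π s = lookup∘tabulate _

  flip-involutive : ∀ π s → flip π (flip π s) ≡ s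
  flip-involutive π s =
    trans (tabulate-cong λ e → trans (cong (_xor π e) (lookup-flip π s e)) (xor-cancelʳ (lookup s e) (π e)))
          (tabulate∘lookup s)

  module _ (π : Flip G) where

    vertexParity-flip : ∀ s v → vertexParity (flip (proj₁ π) s) v ≡ vertexParity s v
    vertexParity-flip s v = begin
      vertexParity (flip (proj₁ π) s) v
        ≡⟨ cong₂ _xor_ (lookup-flip _ s _) (cong₂ _xor_ (lookup-flip _ s _) (cong (_xor d) (lookup-flip _ s _))) ⟩
      (a xor π₀) xor (b xor π₁) xor (c xor π₂) xor d
        ≡⟨ XorSolver.solve 7 (λ a b c d π₀ π₁ π₂ → (a ⊞ π₀) ⊞ ((b ⊞ π₁) ⊞ ((c ⊞ π₂) ⊞ d))
                                                  ⊜ (a ⊞ (b ⊞ (c ⊞ d))) ⊞ (π₀ ⊞ (π₁ ⊞ π₂)))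
                             refl a b c d π₀ π₁ π₂ ⟩
      (a xor b xor c xor d) xor (π₀ xor π₁ xor π₂)
        ≡⟨ cong ((a xor b xor c xor d) xor_) (proj₂ π v) ⟩
      (a xor b xor c xor d) xor false
        ≡⟨ xor-identityʳ _ ⟩
      vertexParity s v ∎
      where
      open ≡.≡-Reasoning
      a = lookup s (e₀ G v) ; b = lookup s (e₁ G v) ; c = lookup s (e₂ G v) ; d = does (v ≟ u) ∧ true
      π₀ = proj₁ π (e₀ G v) ; π₁ = proj₁ π (e₁ G v) ; π₂ = proj₁ π (e₂ G v)

    violatedVertex-flip : ∀ s → violatedVertex (flip (proj₁ π) s) ≡ violatedVertex s
    violatedVertex-flip s = cong firstFalse (tabulate-cong (vertexParity-flip s))

-- The certificate and its circuit

concatMap≡cartesianProductWith : ∀ {C : Set} (f : A → B → C) (xs : List A) (ys : List B) →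
                concatMap (λ x → map (f x) ys) xs ≡ cartesianProductWith f xs ys
concatMap≡cartesianProductWith f []       ys = refl
concatMap≡cartesianProductWith f (x ∷ xs) ys = cong (map (f x) ys ++_) (concatMap≡cartesianProductWith f xs ys)

module AxiomIndices (G : CubicGraph) where
  open CubicGraph G

  _≟ᵢ_ : DecidableEquality (CFIIdx G)
  vtx v i j k ≟ᵢ vtx v′ i′ j′ k′ =
    map′ (λ { (refl , refl , refl , refl) → refl }) (λ { refl → refl , refl , refl , refl })
         (v ≟ v′ ×-dec i Bool.≟ i′ ×-dec j Bool.≟ j′ ×-dec k Bool.≟ k′)
  vtx _ _ _ _ ≟ᵢ edg _       = no λ ()
  vtx _ _ _ _ ≟ᵢ bool _      = no λ ()
  edg _       ≟ᵢ vtx _ _ _ _ = no λ ()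
  edg e       ≟ᵢ edg e′      = map′ (cong edg) (λ { refl → refl }) (e ≟ e′)
  edg _       ≟ᵢ bool _      = no λ ()
  bool _      ≟ᵢ vtx _ _ _ _ = no λ ()
  bool _      ≟ᵢ edg _       = no λ ()
  bool a      ≟ᵢ bool a′     = map′ (cong bool) (λ { refl → refl }) (×-≡-dec _≟_ Bool._≟_ a a′)

  private
    vtxIdx : Fin nv → Bool × Bool × Bool → CFIIdx G
    vtxIdx v (i , j , k) = vtx v i j k

    triples : List (Bool × Bool × Bool)
    triples = cartesianProduct (bools G) (cartesianProduct (bools G) (bools G))

    vertexAxioms edgeAxioms booleanAxioms : List (CFIIdx G)
    vertexAxioms  = cartesianProductWith vtxIdx (allFin nv) triples
    edgeAxioms    = map edg (allFin ne)
    booleanAxioms = map bool (cartesianProduct (allFin ne) (bools G))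

    allCFIIdx-≡ : allCFIIdx G ≡ vertexAxioms ++ edgeAxioms ++ booleanAxioms
    allCFIIdx-≡ = cong₂ _++_ (concatMap≡cartesianProductWith vtxIdx (allFin nv) triples)
                             (cong (λ xs → edgeAxioms ++ map bool xs) (concatMap≡cartesianProductWith _,_ (allFin ne) (bools G)))

    bools-unique : Unique (bools G)
    bools-unique = ((λ ()) ∷ []) ∷ [] ∷ []

    ∈-bools : ∀ b → b ∈ bools G
    ∈-bools false = here refl
    ∈-bools true  = there (here refl)

  allCFIIdx-unique : Unique (allCFIIdx G)
  allCFIIdx-unique = ≡.subst Unique (sym allCFIIdx-≡)
    (Unique.++⁺ (Unique.cartesianProductWith⁺ vtxIdx (λ { refl → refl , refl }) (Unique.allFin⁺ nv)
                   (Unique.cartesianProduct⁺ bools-unique (Unique.cartesianProduct⁺ bools-unique bools-unique)))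
       (Unique.++⁺ (Unique.map⁺ (λ { refl → refl }) (Unique.allFin⁺ ne))
                   (Unique.map⁺ (λ { refl → refl }) (Unique.cartesianProduct⁺ (Unique.allFin⁺ ne) bools-unique))
                   edge≢boolean)
       vertex≢other)
    where
    edge≢boolean : ∀ {y} → y ∈ edgeAxioms × y ∈ booleanAxioms → ⊥
    edge≢boolean (p , q) with ∈-map⁻ edg p | ∈-map⁻ bool q
    ... | _ , _ , refl | _ , _ , ()
    vertex≢other : ∀ {y} → y ∈ vertexAxioms × y ∈ edgeAxioms ++ booleanAxioms → ⊥
    vertex≢other (p , q) with ∈-cartesianProductWith⁻ vtxIdx (allFin nv) triples p
    ... | _ , _ , _ , _ , refl with ∈-++⁻ edgeAxioms q
    ...   | inj₁ q′ with ∈-map⁻ edg q′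
    ...     | _ , _ , ()
    vertex≢other (p , q) | _ , _ , _ , _ , refl | inj₂ q′ with ∈-map⁻ bool q′
    ...     | _ , _ , ()

  ∈-allCFIIdx : ∀ y → y ∈ allCFIIdx G
  ∈-allCFIIdx y = ≡.subst (y ∈_) (sym allCFIIdx-≡) (∈-axioms y)
    where
    ∈-axioms : ∀ y → y ∈ vertexAxioms ++ edgeAxioms ++ booleanAxioms
    ∈-axioms (vtx v i j k)  = ∈-++⁺ˡ (∈-cartesianProductWith⁺ vtxIdx (∈-allFin v)
                                (∈-cartesianProduct⁺ (∈-bools i) (∈-cartesianProduct⁺ (∈-bools j) (∈-bools k))))
    ∈-axioms (edg e)        = ∈-++⁺ʳ vertexAxioms (∈-++⁺ˡ (∈-map⁺ edg (∈-allFin e)))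
    ∈-axioms (bool (e , i)) = ∈-++⁺ʳ vertexAxioms (∈-++⁺ʳ edgeAxioms
                                (∈-map⁺ bool (∈-cartesianProduct⁺ (∈-allFin e) (∈-bools i))))

module Certificate (G : CubicGraph) (u : Fin (CubicGraph.nv G)) where
  open CubicGraph G
  open Violation G u
  open AxiomIndices G

  -- The certificate is ∑_τ y_{axiom τ} · xFactor τ · sumFactor τ over three kinds of terms:
  -- vertexTerm s multiplies the violated vertex axiom of s by mₛ; booleanTerm s t multiplies the
  -- Boolean axiom of the t-th edge e of that vertex by mₛ with the factor xᵉ_{s(e)} removed; and
  -- edgeTerm e multiplies the edge axiom of e by ∏_{e′>e} (xᵉ′₀ + xᵉ′₁).
  Term : Set
  Term = Assignment ⊎ (Assignment × Fin 3) ⊎ Fin ne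

  pattern vertexTerm s    = inj₁ s
  pattern booleanTerm s t = inj₂ (inj₁ (s , t))
  pattern edgeTerm e      = inj₂ (inj₂ e)

  terms : Enumeration Term
  terms = vecEnum ne ⊎ₑ ((vecEnum ne ×ₑ finEnum 3) ⊎ₑ finEnum ne)

  _≟ₜ_ : DecidableEquality Term
  _≟ₜ_ = ⊎-≡-dec (Vec-≡-dec Bool._≟_) (⊎-≡-dec (×-≡-dec (Vec-≡-dec Bool._≟_) _≟_) _≟_)

  edgeAt : Assignment → Fin 3 → Fin ne
  edgeAt s = inc (violatedVertex s)

  vertexAxiom : Fin nv → Assignment → CFIIdx G
  vertexAxiom v s = vtx v (lookup s (e₀ G v)) (lookup s (e₁ G v)) (lookup s (e₂ G v))

  booleanAxiom : Fin nv → Assignment → Fin 3 → CFIIdx G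
  booleanAxiom v s t = bool (inc v t , lookup s (inc v t))

  axiom : Term → CFIIdx G
  axiom (vertexTerm s)    = vertexAxiom (violatedVertex s) s
  axiom (booleanTerm s t) = booleanAxiom (violatedVertex s) s t
  axiom (edgeTerm e)      = edg e

  usesX : Term → XVar G → Bool
  usesX (vertexTerm s)    (e , i) = does (lookup s e Bool.≟ i)
  usesX (booleanTerm s t) (e , i) = not (does (edgeAt s t ≟ e)) ∧ does (lookup s e Bool.≟ i)
  usesX (edgeTerm _)      _       = false

  usesSum : Term → Fin ne → Bool
  usesSum (edgeTerm e) e′ = does (e <? e′)
  usesSum _            _  = false

  xvars : Enumeration (XVar G)
  xvars = finEnum ne ×ₑ boolEnum

  -- Gates are listed layer by layer, so the enumeration order is topological: the inputs xᵉᵢ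
  -- and y_{axiom τ}, then the edge sums xᵉ₀ + xᵉ₁, then the term products together with two
  -- cancel gates, then the output.  No term reads the edge sum of the first edge; the cancel gates
  -- (each the sum of all edge sums) give it a reader and add up to 0.
  Gate : Set
  Gate = (XVar G ⊎ Term) ⊎ (Fin ne ⊎ ((Term ⊎ Bool) ⊎ ⊤))

  pattern xGate a      = inj₁ (inj₁ a)
  pattern yGate τ      = inj₁ (inj₂ τ)
  pattern sumGate e    = inj₂ (inj₁ e)
  pattern termGate τ   = inj₂ (inj₂ (inj₁ (inj₁ τ)))
  pattern cancelGate b = inj₂ (inj₂ (inj₁ (inj₂ b)))
  pattern outputGate   = inj₂ (inj₂ (inj₂ tt))

  layer₀ : Enumeration (XVar G ⊎ Term)
  layer₀ = xvars ⊎ₑ terms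

  layer₂ : Enumeration (Term ⊎ Bool)
  layer₂ = terms ⊎ₑ boolEnum

  layers₂₃ : Enumeration ((Term ⊎ Bool) ⊎ ⊤)
  layers₂₃ = layer₂ ⊎ₑ ⊤Enum

  layers₁₂₃ : Enumeration (Fin ne ⊎ ((Term ⊎ Bool) ⊎ ⊤))
  layers₁₂₃ = finEnum ne ⊎ₑ layers₂₃

  gates : Enumeration Gate
  gates = layer₀ ⊎ₑ layers₁₂₃

  wire : Gate → Gate → Bool
  wire (sumGate e)    (xGate (e′ , _)) = does (e ≟ e′)
  wire (termGate τ)   (xGate a)        = usesX τ a
  wire (termGate τ)   (yGate τ′)       = does (τ ≟ₜ τ′)
  wire (termGate τ)   (sumGate e)      = usesSum τ e
  wire (cancelGate _) (sumGate _)      = true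
  wire outputGate     (termGate _)     = true
  wire outputGate     (cancelGate _)   = true
  wire _              _                = false

  label : Gate → Label (IPSVar G)
  label (xGate a)      = inp (inj₁ a)
  label (yGate τ)      = inp (inj₂ (axiom τ))
  label (sumGate _)    = plus
  label (termGate _)   = times
  label (cancelGate _) = plus
  label outputGate     = plus

  wire-descends : ∀ g h → wire g h ≡ true → toℕ (encode gates h) < toℕ (encode gates g)
  wire-descends (inj₁ _)       _               ()
  wire-descends (sumGate e)    (inj₁ (inj₁ a)) _ = encode-inj₁<inj₂ layer₀ layers₁₂₃ (inj₁ a) (inj₁ e)
  wire-descends (sumGate _)    (inj₁ (inj₂ _)) ()
  wire-descends (sumGate _)    (inj₂ _)        ()
  wire-descends (termGate τ)   (inj₁ h)        _ = encode-inj₁<inj₂ layer₀ layers₁₂₃ h (inj₂ (inj₁ (inj₁ τ)))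
  wire-descends (termGate τ)   (sumGate e)     _ =
    encode-inj₂-mono layer₀ layers₁₂₃ (inj₁ e) (inj₂ (inj₁ (inj₁ τ)))
      (encode-inj₁<inj₂ (finEnum ne) layers₂₃ e (inj₁ (inj₁ τ)))
  wire-descends (termGate _)   (inj₂ (inj₂ _)) ()
  wire-descends (cancelGate _) (inj₁ _)        ()
  wire-descends (cancelGate b) (sumGate e)     _ =
    encode-inj₂-mono layer₀ layers₁₂₃ (inj₁ e) (inj₂ (inj₁ (inj₂ b)))
      (encode-inj₁<inj₂ (finEnum ne) layers₂₃ e (inj₁ (inj₂ b)))
  wire-descends (cancelGate _) (inj₂ (inj₂ _)) ()
  wire-descends outputGate     (inj₁ _)        ()
  wire-descends outputGate     (sumGate _)     ()
  wire-descends outputGate     (inj₂ (inj₂ (inj₁ h))) _ =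
    encode-inj₂-mono layer₀ layers₁₂₃ (inj₂ (inj₁ h)) (inj₂ (inj₂ tt))
      (encode-inj₂-mono (finEnum ne) layers₂₃ (inj₁ h) (inj₂ tt) (encode-inj₁<inj₂ layer₂ ⊤Enum h tt))
  wire-descends outputGate     outputGate      ()

  input-leaf : ∀ g → IsInputLabel (label g) → ∀ h → wire g h ≡ false
  input-leaf (inj₁ _)       _  _ = refl
  input-leaf (sumGate _)    () _
  input-leaf (termGate _)   () _
  input-leaf (cancelGate _) () _
  input-leaf outputGate     () _

  internal-fan : ∀ g → ¬ IsInputLabel (label g) → ∃ λ h → wire g h ≡ true
  internal-fan (xGate _)      not-input = ⊥-elim (not-input tt)
  internal-fan (yGate _)      not-input = ⊥-elim (not-input tt)
  internal-fan (sumGate e)    _         = xGate (e , false) , dec-true (e ≟ e) refl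
  internal-fan (termGate τ)   _         = yGate τ , dec-true (τ ≟ₜ τ) refl
  internal-fan (cancelGate _) _         = sumGate (inc u 0F) , refl
  internal-fan outputGate     _         = cancelGate false , refl

  output-sink : ∀ g → wire g outputGate ≡ false
  output-sink (inj₁ _)       = refl
  output-sink (sumGate _)    = refl
  output-sink (termGate _)   = refl
  output-sink (cancelGate _) = refl
  output-sink outputGate     = refl

  other-used : ∀ h → h ≢ outputGate → ∃ λ g → wire g h ≡ true
  other-used (xGate (e , _)) _        = sumGate e , dec-true (e ≟ e) refl
  other-used (yGate τ)       _        = termGate τ , dec-true (τ ≟ₜ τ) refl
  other-used (sumGate _)     _        = cancelGate false , refl
  other-used (termGate _)    _        = outputGate , refl
  other-used (cancelGate _)  _        = outputGate , refl
  other-used outputGate      h≢output = ⊥-elim (h≢output refl)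

  netlist : Netlist (IPSVar G)
  netlist = record
    { Gate = Gate ; gates = gates ; label = label ; wire = wire ; wire-descends = wire-descends
    ; input-leaf = input-leaf ; internal-fan = internal-fan ; output = outputGate
    ; output-sink = output-sink ; other-used = other-used }

  flipTerm : (Fin ne → Bool) → Term → Term
  flipTerm π (vertexTerm s)    = vertexTerm (flip π s)
  flipTerm π (booleanTerm s t) = booleanTerm (flip π s) t
  flipTerm π (edgeTerm e)      = edgeTerm e

  flipTerm-involutive : ∀ π τ → flipTerm π (flipTerm π τ) ≡ τ
  flipTerm-involutive π (vertexTerm s)    = cong vertexTerm (flip-involutive π s)
  flipTerm-involutive π (booleanTerm s t) = cong (λ s′ → booleanTerm s′ t) (flip-involutive π s)
  flipTerm-involutive π (edgeTerm e)      = refl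

  flipGate : Flip G → Gate → Gate
  flipGate π = ⊎.map (⊎.map (actX G π) (flipTerm (proj₁ π))) (⊎.map₂ (⊎.map₁ (⊎.map₁ (flipTerm (proj₁ π)))))

  flipGate-involutive : ∀ π g → flipGate π (flipGate π g) ≡ g
  flipGate-involutive π (xGate (e , i)) = cong (λ j → xGate (e , j)) (xor-cancelʳ i (proj₁ π e))
  flipGate-involutive π (yGate τ)       = cong yGate (flipTerm-involutive (proj₁ π) τ)
  flipGate-involutive π (sumGate _)     = refl
  flipGate-involutive π (termGate τ)    = cong termGate (flipTerm-involutive (proj₁ π) τ)
  flipGate-involutive π (cancelGate _)  = refl
  flipGate-involutive π outputGate      = refl

  module _ (π : Flip G) where
    private
      p : Fin ne → Bool
      p = proj₁ π

    lookup-flip-≟ : ∀ s e i → does (lookup (flip p s) e Bool.≟ (i xor p e)) ≡ does (lookup s e Bool.≟ i)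
    lookup-flip-≟ s e i = trans (cong (λ a → does (a Bool.≟ (i xor p e))) (lookup-flip p s e))
      (does-⇔ (mk⇔ xor-injective (cong (_xor p e))) (lookup s e xor p e Bool.≟ i xor p e) (lookup s e Bool.≟ i))
      where
      xor-injective : ∀ {a b} → a xor p e ≡ b xor p e → a ≡ b
      xor-injective {a} {b} eq = trans (sym (xor-cancelʳ a (p e))) (trans (cong (_xor p e) eq) (xor-cancelʳ b (p e)))

    usesX-flip : ∀ τ a → usesX (flipTerm p τ) (actX G π a) ≡ usesX τ a
    usesX-flip (vertexTerm s)    (e , i) = lookup-flip-≟ s e i
    usesX-flip (booleanTerm s t) (e , i) =
      cong₂ (λ v b → not (does (inc v t ≟ e)) ∧ b) (violatedVertex-flip π s) (lookup-flip-≟ s e i)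
    usesX-flip (edgeTerm _)      _       = refl

    usesSum-flip : ∀ τ e → usesSum (flipTerm p τ) e ≡ usesSum τ e
    usesSum-flip (vertexTerm _)    _ = refl
    usesSum-flip (booleanTerm _ _) _ = refl
    usesSum-flip (edgeTerm _)      _ = refl

    flipTerm-injective : ∀ {τ τ′} → flipTerm p τ ≡ flipTerm p τ′ → τ ≡ τ′
    flipTerm-injective {τ} {τ′} eq =
      trans (sym (flipTerm-involutive p τ)) (trans (cong (flipTerm p) eq) (flipTerm-involutive p τ′))

    wire-flip : ∀ g h → wire (flipGate π g) (flipGate π h) ≡ wire g h
    wire-flip (xGate _)      _               = refl
    wire-flip (yGate _)      _               = refl
    wire-flip (sumGate _)    (xGate _)       = refl
    wire-flip (sumGate _)    (yGate _)       = refl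
    wire-flip (sumGate _)    (inj₂ _)        = refl
    wire-flip (termGate τ)   (xGate a)       = usesX-flip τ a
    wire-flip (termGate τ)   (yGate τ′)      =
      does-⇔ (mk⇔ flipTerm-injective (cong (flipTerm p))) (flipTerm p τ ≟ₜ flipTerm p τ′) (τ ≟ₜ τ′)
    wire-flip (termGate τ)   (sumGate e)     = usesSum-flip τ e
    wire-flip (termGate _)   (inj₂ (inj₂ _)) = refl
    wire-flip (cancelGate _) (inj₁ _)        = refl
    wire-flip (cancelGate _) (sumGate _)     = refl
    wire-flip (cancelGate _) (inj₂ (inj₂ _)) = refl
    wire-flip outputGate     (inj₁ _)        = refl
    wire-flip outputGate     (sumGate _)     = refl
    wire-flip outputGate     (termGate _)    = refl
    wire-flip outputGate     (cancelGate _)  = refl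
    wire-flip outputGate     outputGate      = refl

    axiom-flip : ∀ τ → axiom (flipTerm p τ) ≡ actY G π (axiom τ)
    axiom-flip (vertexTerm s) = trans (cong (λ v → vertexAxiom v (flip p s)) (violatedVertex-flip π s))
      (cong₂ (λ a bc → vtx v a (proj₁ bc) (proj₂ bc)) (lookup-flip p s _)
             (cong₂ _,_ (lookup-flip p s _) (lookup-flip p s _)))
      where v = violatedVertex s
    axiom-flip (booleanTerm s t) = trans (cong (λ v → booleanAxiom v (flip p s) t) (violatedVertex-flip π s))
      (cong (λ b → bool (edgeAt s t , b)) (lookup-flip p s _))
    axiom-flip (edgeTerm _) = refl

    label-flip : ∀ g → label (flipGate π g) ≡ mapLabel (actXY G π) (label g)
    label-flip (xGate _)      = refl
    label-flip (yGate τ)      = cong (inp ∘ inj₂) (axiom-flip τ)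
    label-flip (sumGate _)    = refl
    label-flip (termGate _)   = refl
    label-flip (cancelGate _) = refl
    label-flip outputGate     = refl

  symmetric : IsSymmetric (Flip G) (actXY G) (Netlist.circuit netlist)
  symmetric = Netlist.symmetric netlist (Flip G) (actXY G)
    (λ π → mk↔ₛ′ (flipGate π) (flipGate π) (flipGate-involutive π) (flipGate-involutive π)) wire-flip label-flip

  module Values {W : Set} (X : XVar G → Poly W) where
    open CommutativeRing (polyRing W) using (+-identityʳ; zeroˡ; zeroʳ; setoid)
    open import Relation.Binary.Reasoning.Setoid setoid

    edgeSum : Fin ne → Poly W
    edgeSum e = X (e , false) ⊕ X (e , true)

    xFactor : Term → Poly W
    xFactor τ = ∏[ a ∈ elements xvars ] (if usesX τ a then X a else con true)

    sumFactor : Term → Poly W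
    sumFactor τ = ∏[ e ∈ allFin ne ] (if usesSum τ e then edgeSum e else con true)

    cancelValue : Poly W
    cancelValue = ∑[ e ∈ allFin ne ] edgeSum e

    module _ (Y : CFIIdx G → Poly W) where

      termValue : Term → Poly W
      termValue τ = (xFactor τ ⊗ Y (axiom τ)) ⊗ sumFactor τ

      certificate : Poly W
      certificate = ∑[ τ ∈ elements terms ] termValue τ ⊕ ∑[ _ ∈ elements boolEnum ] cancelValue

      polynomial : Gate → Poly W
      polynomial (xGate a)      = X a
      polynomial (yGate τ)      = Y (axiom τ)
      polynomial (sumGate e)    = edgeSum e
      polynomial (termGate τ)   = termValue τ
      polynomial (cancelGate _) = cancelValue
      polynomial outputGate     = certificate

    edgeSum-inputs : ∀ e → ∑[ a ∈ elements xvars ] (if does (e ≟ proj₁ a) then X a else con false) ≈ edgeSum e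
    edgeSum-inputs e = begin
      ∑[ a ∈ elements xvars ] (if does (e ≟ proj₁ a) then X a else con false)
        ≈⟨ SumE.big-× (finEnum ne) boolEnum _ ⟩
      ∑[ e′ ∈ allFin ne ] ∑[ i ∈ elements boolEnum ] (if does (e ≟ e′) then X (e′ , i) else con false)
        ≈⟨ Sum.big-comm (allFin ne) (elements boolEnum) (λ e′ i → if does (e ≟ e′) then X (e′ , i) else con false) ⟩
      ∑[ i ∈ elements boolEnum ] ∑[ e′ ∈ allFin ne ] (if does (e ≟ e′) then X (e′ , i) else con false)
        ≈⟨ Sum.big-cong (elements boolEnum) (λ i →
             Sum.big-δ _≟_ (λ e′ → X (e′ , i)) (Unique.allFin⁺ ne) (∈-allFin e)) ⟩
      X (e , false) ⊕ (X (e , true) ⊕ con false)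
        ≈⟨ ⊕-cong ≈-refl (+-identityʳ _) ⟩
      edgeSum e ∎

    monomial : Assignment → Poly W
    monomial s = ∏[ e ∈ allFin ne ] X (e , lookup s e)

    monomialWithout : Assignment → Fin ne → Poly W
    monomialWithout s e′ = ∏[ e ∈ allFin ne ] (if does (e′ ≟ e) then con true else X (e , lookup s e))

    monomial-split : ∀ s e → monomial s ≈ X (e , lookup s e) ⊗ monomialWithout s e
    monomial-split s e = Prod.big-split _≟_ (λ e → X (e , lookup s e)) (Unique.allFin⁺ ne) (∈-allFin e)

    xFactor-vertexTerm : ∀ s → xFactor (vertexTerm s) ≈ monomial s
    xFactor-vertexTerm s = ≈-trans (ProdE.big-× (finEnum ne) boolEnum _) (Prod.big-cong (allFin ne) λ e →
      Prod.big-δ Bool._≟_ (λ i → X (e , i)) (elements-unique boolEnum) (∈-elements boolEnum _))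

    xFactor-booleanTerm : ∀ s t → xFactor (booleanTerm s t) ≈ monomialWithout s (edgeAt s t)
    xFactor-booleanTerm s t = ≈-trans (ProdE.big-× (finEnum ne) boolEnum _) (Prod.big-cong (allFin ne) λ e →
      except (does (edgeAt s t ≟ e)) e)
      where
      except : ∀ d e → ∏[ i ∈ elements boolEnum ] (if not d ∧ does (lookup s e Bool.≟ i) then X (e , i) else con true)
                       ≈ (if d then con true else X (e , lookup s e))
      except true  e = Prod.big-ε (elements boolEnum) (λ _ → ≈-refl)
      except false e = Prod.big-δ Bool._≟_ (λ i → X (e , i)) (elements-unique boolEnum) (∈-elements boolEnum _)

    xFactor-edgeTerm : ∀ e → xFactor (edgeTerm e) ≈ con true
    xFactor-edgeTerm e = Prod.big-ε (elements xvars) (λ _ → ≈-refl)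

    sumFactor-vertexTerm : ∀ s → sumFactor (vertexTerm s) ≈ con true
    sumFactor-vertexTerm s = Prod.big-ε (allFin ne) (λ _ → ≈-refl)

    sumFactor-booleanTerm : ∀ s t → sumFactor (booleanTerm s t) ≈ con true
    sumFactor-booleanTerm s t = Prod.big-ε (allFin ne) (λ _ → ≈-refl)

    cancelValue-twice : ∑[ _ ∈ elements boolEnum ] cancelValue ≈ con false
    cancelValue-twice = ≈-trans (⊕-cong ≈-refl (+-identityʳ cancelValue)) (⊕-self cancelValue)

    certificate-zero : certificate (λ _ → con false) ≈ con false
    certificate-zero = ≈-trans
      (⊕-cong (Sum.big-ε (elements terms) λ τ → ≈-trans (⊗-cong (zeroʳ _) ≈-refl) (zeroˡ _)) cancelValue-twice)
      (+-identityʳ (con false))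

  module _ {W W′ : Set} (X : XVar G → Poly W) (σ : W → Poly W′) where
    open Values X
    private module V′ = Values (subst σ ∘ X)

    subst-xFactor : ∀ τ → subst σ (xFactor τ) ≡ V′.xFactor τ
    subst-xFactor τ =
      trans (subst-∏ σ (elements xvars) _) (Prod.big-cong-≡ (elements xvars) λ a → subst-if σ (usesX τ a) _ _)

    subst-sumFactor : ∀ τ → subst σ (sumFactor τ) ≡ V′.sumFactor τ
    subst-sumFactor τ =
      trans (subst-∏ σ (allFin ne) _) (Prod.big-cong-≡ (allFin ne) λ e → subst-if σ (usesSum τ e) _ _)

    subst-certificate : ∀ Y → subst σ (certificate Y) ≡ V′.certificate (subst σ ∘ Y)
    subst-certificate Y = cong₂ _⊕_
      (trans (subst-∑ σ (elements terms) (termValue Y)) (Sum.big-cong-≡ (elements terms) λ τ →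
        cong₂ _⊗_ (cong (_⊗ subst σ (Y (axiom τ))) (subst-xFactor τ)) (subst-sumFactor τ)))
      (trans (subst-∑ σ (elements boolEnum) (λ _ → cancelValue)) (Sum.big-cong-≡ (elements boolEnum) λ _ →
        subst-∑ σ (allFin ne) edgeSum))

  module IPS = Values {IPSVar G} (var ∘ inj₁)

  gatePolynomial : Gate → Poly (IPSVar G)
  gatePolynomial = IPS.polynomial (var ∘ inj₂)

  evaluation : Netlist.IsEvaluation netlist gatePolynomial
  evaluation (xGate _)      = ≈-refl
  evaluation (yGate _)      = ≈-refl
  evaluation (sumGate e)    = ≈-sym (≈-trans (SumE.big-inj₁ layer₀ layers₁₂₃ _ (λ _ → ≈-refl))
    (≈-trans (SumE.big-inj₁ xvars terms _ (λ _ → ≈-refl)) (IPS.edgeSum-inputs e)))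
  evaluation (termGate τ)   = ≈-sym (≈-trans (ProdE.big-⊎ layer₀ layers₁₂₃ _)
    (⊗-cong (≈-trans (ProdE.big-⊎ xvars terms _)
                     (⊗-cong ≈-refl
                       (Prod.big-δ _≟ₜ_ (var ∘ inj₂ ∘ axiom) (elements-unique terms) (∈-elements terms τ))))
            (ProdE.big-inj₁ (finEnum ne) layers₂₃ _ (λ _ → ≈-refl))))
  evaluation (cancelGate _) = ≈-sym (≈-trans (SumE.big-inj₂ layer₀ layers₁₂₃ _ (λ _ → ≈-refl))
    (SumE.big-inj₁ (finEnum ne) layers₂₃ _ (λ _ → ≈-refl)))
  evaluation outputGate     = ≈-sym (≈-trans (SumE.big-inj₂ layer₀ layers₁₂₃ _ (λ _ → ≈-refl))
    (≈-trans (SumE.big-inj₂ (finEnum ne) layers₂₃ _ (λ _ → ≈-refl))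
    (≈-trans (SumE.big-inj₁ layer₂ ⊤Enum _ (λ _ → ≈-refl)) (SumE.big-⊎ terms boolEnum _))))

  computes-certificate : computes (Netlist.circuit netlist) ≈ IPS.certificate (var ∘ inj₂)
  computes-certificate = Netlist.computes-≈ netlist gatePolynomial evaluation

  module _ where
    open Values {XVar G} var
    open CommutativeRing (polyRing (XVar G)) using (+-assoc; +-identityʳ; *-identityˡ; *-identityʳ; setoid)
    open import Relation.Binary.Reasoning.Setoid setoid
    open Char2Solver (XVar G)

    private
      f : CFIIdx G → Poly (XVar G)
      f = CFI G u true

    assignment-terms : ∀ s → termValue f (vertexTerm s) ⊕ ∑[ t ∈ allFin 3 ] termValue f (booleanTerm s t) ≈ monomial s
    assignment-terms s = begin
      termValue f (vertexTerm s) ⊕ ∑[ t ∈ allFin 3 ] termValue f (booleanTerm s t)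
        ≈⟨ ⊕-cong vertex-term (Sum.big-cong (allFin 3) boolean-term) ⟩
      M ⊗ (((x 0F ⊕ x 1F) ⊕ x 2F) ⊕ con false) ⊕ ∑[ t ∈ allFin 3 ] (x t ⊗ M ⊕ M)
        ≈⟨ solve 4 (λ m a b c → m :* (((a :+ b) :+ c) :+ κ false)
                                  :+ ((a :* m :+ m) :+ ((b :* m :+ m) :+ ((c :* m :+ m) :+ κ false)))
                                := m)
                   ≈-refl M (x 0F) (x 1F) (x 2F) ⟩
      M ∎
      where
      M : Poly (XVar G)
      M = monomial s
      x : Fin 3 → Poly (XVar G)
      x t = var (edgeAt s t , lookup s (edgeAt s t))
      vertex-term : termValue f (vertexTerm s) ≈ M ⊗ (((x 0F ⊕ x 1F) ⊕ x 2F) ⊕ con false)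
      vertex-term = ≈-trans (⊗-cong (⊗-cong (xFactor-vertexTerm s) violated) (sumFactor-vertexTerm s)) (*-identityʳ _)
        where
        violated : f (axiom (vertexTerm s)) ≈ ((x 0F ⊕ x 1F) ⊕ x 2F) ⊕ con false
        violated = ≡⇒≈ (cong (λ b → ((x 0F ⊕ x 1F) ⊕ x 2F) ⊕ con b) (violatedVertex-parity s))
      boolean-term : ∀ t → termValue f (booleanTerm s t) ≈ x t ⊗ M ⊕ M
      boolean-term t = begin
        (xFactor (booleanTerm s t) ⊗ (x t ⊗ x t ⊕ x t)) ⊗ sumFactor (booleanTerm s t)
          ≈⟨ ⊗-cong (⊗-cong (xFactor-booleanTerm s t) ≈-refl) (sumFactor-booleanTerm s t) ⟩
        (M′ ⊗ (x t ⊗ x t ⊕ x t)) ⊗ con true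
          ≈⟨ solve 2 (λ m′ y → (m′ :* (y :* y :+ y)) :* κ true := y :* (y :* m′) :+ y :* m′) ≈-refl M′ (x t) ⟩
        x t ⊗ (x t ⊗ M′) ⊕ x t ⊗ M′
          ≈⟨ ⊕-cong (⊗-cong ≈-refl (≈-sym (monomial-split s (edgeAt s t)))) (≈-sym (monomial-split s (edgeAt s t))) ⟩
        x t ⊗ M ⊕ M ∎
        where
        M′ : Poly (XVar G)
        M′ = monomialWithout s (edgeAt s t)

    edge-term : ∀ e → termValue f (edgeTerm e) ≈ (edgeSum e ⊕ con true) ⊗ sumFactor (edgeTerm e)
    edge-term e = ⊗-cong (≈-trans (⊗-cong (xFactor-edgeTerm e) ≈-refl) (*-identityˡ _)) ≈-refl

    certificate-one : certificate f ≈ con true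
    certificate-one = begin
      ∑[ τ ∈ elements terms ] termValue f τ ⊕ ∑[ _ ∈ elements boolEnum ] cancelValue
        ≈⟨ ≈-trans (⊕-cong ≈-refl cancelValue-twice) (+-identityʳ _) ⟩
      ∑[ τ ∈ elements terms ] termValue f τ
        ≈⟨ ≈-trans (SumE.big-⊎ (vecEnum ne) ((vecEnum ne ×ₑ finEnum 3) ⊎ₑ finEnum ne) (termValue f))
                   (⊕-cong ≈-refl (SumE.big-⊎ (vecEnum ne ×ₑ finEnum 3) (finEnum ne) (termValue f ∘ inj₂))) ⟩
      ∑[ s ∈ assignments ] termValue f (vertexTerm s)
        ⊕ (∑[ (s , t) ∈ elements (vecEnum ne ×ₑ finEnum 3) ] termValue f (booleanTerm s t) ⊕ edgeTerms)
        ≈⟨ ⊕-cong ≈-refl (⊕-cong (SumE.big-× (vecEnum ne) (finEnum 3) _) ≈-refl) ⟩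
      ∑[ s ∈ assignments ] termValue f (vertexTerm s)
        ⊕ (∑[ s ∈ assignments ] ∑[ t ∈ allFin 3 ] termValue f (booleanTerm s t) ⊕ edgeTerms)
        ≈⟨ ≈-trans (≈-sym (+-assoc _ _ _)) (⊕-cong (≈-sym (Sum.big-distrib assignments _ _)) ≈-refl) ⟩
      ∑[ s ∈ assignments ] (termValue f (vertexTerm s) ⊕ ∑[ t ∈ allFin 3 ] termValue f (booleanTerm s t)) ⊕ edgeTerms
        ≈⟨ ⊕-cong (Sum.big-cong assignments assignment-terms) (Sum.big-cong (allFin ne) edge-term) ⟩
      ∑[ s ∈ assignments ] monomial s ⊕ ∑[ e ∈ allFin ne ] ((edgeSum e ⊕ con true) ⊗ sumFactor (edgeTerm e))
        ≈⟨ ⊕-cong (expansion ne (λ e i → var (e , i))) ≈-refl ⟩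
      ∏[ e ∈ allFin ne ] edgeSum e ⊕ ∑[ e ∈ allFin ne ] ((edgeSum e ⊕ con true) ⊗ sumFactor (edgeTerm e))
        ≈⟨ telescope ne edgeSum ⟩
      con true ∎
      where
      assignments : List Assignment
      assignments = elements (vecEnum ne)
      edgeTerms : Poly (XVar G)
      edgeTerms = ∑[ e ∈ allFin ne ] termValue f (edgeTerm e)

  coefficient : CFIIdx G → Poly (XVar G)
  coefficient y =
    ∑[ τ ∈ elements terms ] (if does (axiom τ ≟ᵢ y) then Values.xFactor var τ ⊗ Values.sumFactor var τ else con false)

  module _ where
    open CommutativeRing (polyRing (IPSVar G)) using (+-identityʳ; zeroʳ; setoid)
    open import Relation.Binary.Reasoning.Setoid setoid
    open Char2Solver (IPSVar G)

    private
      Y : CFIIdx G → Poly (IPSVar G)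
      Y = var ∘ inj₂

      c : Term → Poly (IPSVar G)
      c τ = IPS.xFactor τ ⊗ IPS.sumFactor τ

      rename-coefficient : ∀ y → rename inj₁ (coefficient y)
                                 ≡ ∑[ τ ∈ elements terms ] (if does (axiom τ ≟ᵢ y) then c τ else con false)
      rename-coefficient y = trans (subst-∑ (var ∘ inj₁) (elements terms) _) (Sum.big-cong-≡ (elements terms) λ τ →
        trans (subst-if (var ∘ inj₁) (does (axiom τ ≟ᵢ y)) _ _)
              (cong (λ p → if does (axiom τ ≟ᵢ y) then p else con false)
                    (cong₂ _⊗_ (subst-xFactor var (var ∘ inj₁) τ) (subst-sumFactor var (var ∘ inj₁) τ))))

      ⊗-if : ∀ b (p q : Poly (IPSVar G)) → p ⊗ (if b then q else con false) ≈ (if b then p ⊗ q else con false)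
      ⊗-if true  p q = ≈-refl
      ⊗-if false p q = zeroʳ p

    y-linear : IPS.certificate Y ≈ ΣP (map (λ y → var (inj₂ y) ⊗ rename inj₁ (coefficient y)) (allCFIIdx G))
    y-linear = ≈-sym (begin
      ∑[ y ∈ allCFIIdx G ] (Y y ⊗ rename inj₁ (coefficient y))
        ≡⟨ Sum.big-cong-≡ (allCFIIdx G) (λ y → cong (Y y ⊗_) (rename-coefficient y)) ⟩
      ∑[ y ∈ allCFIIdx G ] (Y y ⊗ ∑[ τ ∈ elements terms ] (if does (axiom τ ≟ᵢ y) then c τ else con false))
        ≈⟨ Sum.big-cong (allCFIIdx G) (λ y → ≈-trans (∑-distribˡ (Y y) (elements terms) _)
                                          (Sum.big-cong (elements terms) λ τ → ⊗-if (does (axiom τ ≟ᵢ y)) (Y y) (c τ))) ⟩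
      ∑[ y ∈ allCFIIdx G ] ∑[ τ ∈ elements terms ] (if does (axiom τ ≟ᵢ y) then Y y ⊗ c τ else con false)
        ≈⟨ Sum.big-comm (allCFIIdx G) (elements terms) _ ⟩
      ∑[ τ ∈ elements terms ] ∑[ y ∈ allCFIIdx G ] (if does (axiom τ ≟ᵢ y) then Y y ⊗ c τ else con false)
        ≈⟨ Sum.big-cong (elements terms) (λ τ →
             Sum.big-δ _≟ᵢ_ (λ y → Y y ⊗ c τ) allCFIIdx-unique (∈-allCFIIdx (axiom τ))) ⟩
      ∑[ τ ∈ elements terms ] (Y (axiom τ) ⊗ c τ)
        ≈⟨ Sum.big-cong (elements terms) (λ τ → solve 3 (λ y x s → y :* (x :* s) := (x :* y) :* s) ≈-refl
                                                          (Y (axiom τ)) (IPS.xFactor τ) (IPS.sumFactor τ)) ⟩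
      ∑[ τ ∈ elements terms ] IPS.termValue Y τ
        ≈⟨ ≈-sym (≈-trans (⊕-cong ≈-refl IPS.cancelValue-twice) (+-identityʳ _)) ⟩
      IPS.certificate Y ∎)

  refutation : IsSymYLinearIPSRefutation G u true (Netlist.circuit netlist)
  refutation = symmetric
    , ≈-trans (subst-cong _ computes-certificate)
              (≈-trans (≡⇒≈ (subst-certificate (var ∘ inj₁) _ (var ∘ inj₂))) (Values.certificate-zero var))
    , ≈-trans (subst-cong _ computes-certificate)
              (≈-trans (≡⇒≈ (subst-certificate (var ∘ inj₁) _ (var ∘ inj₂))) certificate-one)
    , coefficient , ≈-trans computes-certificate y-linear


n≤2^n : ∀ n → n ≤ 2 ^ n
n≤2^n zero    = z≤n
n≤2^n (suc n) = +-mono-≤ (m^n>0 2 n) (≤-trans (n≤2^n n) (m≤m+n _ 0))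

vertices≤2*edges : ∀ (G : CubicGraph) → CubicGraph.nv G ≤ CubicGraph.ne G * 2
vertices≤2*edges G =
  injective⇒≤ {f = encode edgeSides ∘ firstEdge} λ eq → firstEdge-injective (encode-injective edgeSides eq)
  where
  open CubicGraph G

  edgeSides : Enumeration (Fin ne × Bool)
  edgeSides = finEnum ne ×ₑ boolEnum

  firstEdge : Fin nv → Fin ne × Bool
  firstEdge v = inc v 0F , does (proj₁ (ends (inc v 0F)) ≟ v)

  same-endpoint : ∀ {p q v w} → p ≢ q → p ≡ v ⊎ q ≡ v → p ≡ w ⊎ q ≡ w →
                  does (p ≟ v) ≡ does (p ≟ w) → v ≡ w
  same-endpoint _         (inj₁ refl) (inj₁ refl) _    = refl
  same-endpoint _         (inj₂ refl) (inj₂ refl) _    = refl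
  same-endpoint {p} {q} p≢q (inj₁ refl) (inj₂ refl) side
    with () ← trans (sym (dec-true (p ≟ p) refl)) (trans side (dec-false (p ≟ q) p≢q))
  same-endpoint {p} {q} p≢q (inj₂ refl) (inj₁ refl) side
    with () ← trans (sym (dec-false (p ≟ q) p≢q)) (trans side (dec-true (p ≟ p) refl))

  firstEdge-injective : ∀ {v w} → firstEdge v ≡ firstEdge w → v ≡ w
  firstEdge-injective {v} {w} eq = same-endpoint (loopless (inc v 0F))
    (Equivalence.from (inc-spec v (inc v 0F)) (0F , refl))
    (Equivalence.from (inc-spec w (inc v 0F)) (0F , sym same-edge))
    (trans (cong proj₂ eq) (cong (λ e → does (proj₁ (ends e) ≟ w)) (sym same-edge)))
    where
    same-edge : inc v 0F ≡ inc w 0F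
    same-edge = cong proj₁ eq

gateCount-bound : ∀ n S → S ≡ 2 ^ n →
                  (n * 2 + (S + (S * 3 + n))) + (n + (((S + (S * 3 + n)) + 2) + 1)) ≤ 21 * 2 ^ n
gateCount-bound n _ refl = begin
  (n * 2 + (N + (N * 3 + n))) + (n + (((N + (N * 3 + n)) + 2) + 1))
    ≡⟨ solve 2 (λ n N → (n :* con 2 :+ (N :+ (N :* con 3 :+ n))) :+ (n :+ (((N :+ (N :* con 3 :+ n)) :+ con 2) :+ con 1))
                        := con 5 :* n :+ con 8 :* N :+ con 3) refl n N ⟩
  5 * n + 8 * N + 3
    ≤⟨ +-mono-≤ (+-monoˡ-≤ (8 * N) (*-monoʳ-≤ 5 (n≤2^n n))) (*-monoʳ-≤ 3 (m^n>0 2 n)) ⟩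
  5 * N + 8 * N + 3 * N
    ≡⟨ solve 1 (λ N → con 5 :* N :+ con 8 :* N :+ con 3 :* N := con 16 :* N) refl N ⟩
  16 * N
    ≤⟨ *-monoˡ-≤ N (m≤m+n 16 5) ⟩
  21 * N ∎
  where
  open ≤-Reasoning
  open +-*-Solver
  N = 2 ^ n

variableCount-bound : ∀ n m → m ≤ n * 2 → 2 * n + (8 * m + n + 2 * n) ≤ 21 * 2 ^ n
variableCount-bound n m m≤2n = begin
  2 * n + (8 * m + n + 2 * n)
    ≤⟨ +-monoʳ-≤ (2 * n) (+-monoˡ-≤ (2 * n) (+-monoˡ-≤ n (*-monoʳ-≤ 8 m≤2n))) ⟩
  2 * n + (8 * (n * 2) + n + 2 * n)
    ≡⟨ solve 1 (λ n → con 2 :* n :+ (con 8 :* (n :* con 2) :+ n :+ con 2 :* n) := con 21 :* n) refl n ⟩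
  21 * n
    ≤⟨ *-monoʳ-≤ 21 (n≤2^n n) ⟩
  21 * 2 ^ n ∎
  where
  open ≤-Reasoning
  open +-*-Solver

ipsSize-bound : ∀ G u → ipsSize G (Netlist.circuit (Certificate.netlist G u)) ≤ 21 * 2 ^ CubicGraph.ne G
ipsSize-bound G u = ⊔-lub (gateCount-bound ne _ (vecEnum-size ne)) (variableCount-bound ne nv (vertices≤2*edges G))
  where open CubicGraph G

theorem6p3 : (G : ℕ → CubicGraph) →
    ∃ λ (c : ℕ) → ∀ (n : ℕ) (u : Fin (CubicGraph.nv (G n))) →
      Σ (Circuit (IPSVar (G n))) λ C →
        IsSymYLinearIPSRefutation (G n) u true C
        × ipsSize (G n) C ≤ c * 2 ^ CubicGraph.ne (G n)
theorem6p3 G = 21 , λ n u →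
  Netlist.circuit (Certificate.netlist (G n) u) , Certificate.refutation (G n) u , ipsSize-bound (G n) u
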